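{- Let $\mathcal{M}_n$ be the set of perfect matchings of $\{1,2,\dots,2n\}$. Then $$\sum_{n\ge0}\sum_{M\in\mathcal{M}_n} r^{c(M)}s^{p(M)}t^{\mathrm{da}(M)}\frac{x^n}{n!}=\frac{e^{(r-t)x+(s-t^2)x^2}}{\sqrt{1-2tx}}.$$
   Context: For $M\in\mathcal{M}_n$ and $A\subseteq\{1,\dots,2n\}$ let $\overline{A}=\{2n+1-i: i\in A\}$. Each arc (matched pair) $\{i,j\}\in M$ is: centered if $j=2n+1-i$; coupled if it is not centered but $\overline{\{i,j\}}\in M$ (then $\{i,j\}$ and $\overline{\{i,j\}}$ form a pair of coupled arcs); asymmetric otherwise. $c(M)$ is the number of centered arcs, $p(M)$ the number of pairs of coupled arcs, and $\mathrm{da}(M)$ (degree of asymmetry) the number of asymmetric arcs. -}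

module Defs where

open import Level using (Level)
open import Data.Nat as ℕ using (ℕ; zero; suc; _∸_)
open import Data.Nat.Combinatorics using (_C_)
open import Data.Fin as Fin using (Fin; toℕ; opposite)
open import Data.Fin.Properties using (all?; _≟_)
open import Data.Vec as Vec using (Vec; []; _∷_; lookup)
open import Data.List as List using (List; []; _∷_; [_]; map; concatMap; filter; length; upTo; allFin; zipWith; foldr)
open import Data.Product using (_×_)
open import Relation.Nullary using (¬_; Dec; yes; no)
open import Relation.Nullary.Decidable using (_×-dec_; ¬?)
open import Relation.Binary.PropositionalEquality using (_≡_; _≢_)
import Algebra.Bundles
open import Algebra.Bundles using (CommutativeRing)

-- Perfect matchings of {1,…,2n}, represented on Fin (2n) (0-based).
-- A perfect matching is a fixed-point-free involution m; its arcs are the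
-- pairs {i, m i}.  The mirror map i ↦ 2n+1-i becomes `opposite`.

allVecs : ∀ {a} {A : Set a} → List A → (k : ℕ) → List (Vec A k)
allVecs xs zero    = [ [] ]
allVecs xs (suc k) = concatMap (λ x → map (x ∷_) (allVecs xs k)) xs

IsPerfectMatching : ∀ {k} → Vec (Fin k) k → Set
IsPerfectMatching {k} m = ∀ (i : Fin k) → (lookup m i ≢ i) × (lookup m (lookup m i) ≡ i)

isPerfectMatching? : ∀ {k} (m : Vec (Fin k) k) → Dec (IsPerfectMatching m)
isPerfectMatching? m = all? (λ i → ¬? (lookup m i ≟ i) ×-dec (lookup m (lookup m i) ≟ i))

matchings : (n : ℕ) → List (Vec (Fin (2 ℕ.* n)) (2 ℕ.* n))
matchings n = filter isPerfectMatching? (allVecs (allFin (2 ℕ.* n)) (2 ℕ.* n))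

countFin : ∀ {k} {P : Fin k → Set} → (∀ i → Dec (P i)) → ℕ
countFin {k} P? = length (filter P? (allFin k))

module _ {k : ℕ} (m : Vec (Fin k) k) where
  -- each arc {i, m i} is represented by its smaller endpoint i < m i
  IsArcStart : Fin k → Set
  IsArcStart i = toℕ i ℕ.< toℕ (lookup m i)

  Centered : Fin k → Set
  Centered i = lookup m i ≡ opposite i

  MirrorIsArc : Fin k → Set
  MirrorIsArc i = lookup m (opposite i) ≡ opposite (lookup m i)

  centeredArc? : ∀ i → Dec (IsArcStart i × Centered i)
  centeredArc? i = (toℕ i ℕ.<? toℕ (lookup m i)) ×-dec (lookup m i ≟ opposite i)

  coupledArc? : ∀ i → Dec (IsArcStart i × (¬ Centered i) × MirrorIsArc i)
  coupledArc? i = (toℕ i ℕ.<? toℕ (lookup m i)) ×-dec (¬? (lookup m i ≟ opposite i)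
                    ×-dec (lookup m (opposite i) ≟ opposite (lookup m i)))

  asymArc? : ∀ i → Dec (IsArcStart i × (¬ Centered i) × (¬ MirrorIsArc i))
  asymArc? i = (toℕ i ℕ.<? toℕ (lookup m i)) ×-dec (¬? (lookup m i ≟ opposite i)
                    ×-dec ¬? (lookup m (opposite i) ≟ opposite (lookup m i)))

  cM : ℕ
  cM = countFin centeredArc?

  -- p(M): number of pairs of coupled arcs (coupled arcs come in pairs)
  pM : ℕ
  pM = countFin coupledArc? ℕ./ 2

  daM : ℕ
  daM = countFin asymArc?

-- Exponential generating functions over a commutative ring R.
-- A sequence a : ℕ → R stands for the formal series Σ aₙ xⁿ / n!.

module EGF {c ℓ} (R : CommutativeRing c ℓ) where
  open CommutativeRing R
  open import Algebra.Definitions.RawSemiring (Algebra.Bundles.Semiring.rawSemiring semiring) using (_^_) renaming (_×_ to _·ℕ_)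

  sumR : List Carrier → Carrier
  sumR = foldr _+_ 0#

  _⊛_ : (ℕ → Carrier) → (ℕ → Carrier) → ℕ → Carrier
  (a ⊛ b) n = sumR (map (λ k → (n C k) ·ℕ (a k * b (n ∸ k))) (upTo (suc n)))

  -- exp(g) for an EGF g with g₀ = 0, defined by E(0) = 1, E' = g' E, i.e.
  -- E_{n+1} = Σ_{k≤n} C(n,k) g_{k+1} E_{n-k}.
  -- expUpTo g n = [E_n, E_{n-1}, …, E_0]
  expUpTo : (ℕ → Carrier) → ℕ → List Carrier
  expUpTo g zero    = [ 1# ]
  expUpTo g (suc n) =
    sumR (zipWith (λ k e → (n C k) ·ℕ (g (suc k) * e)) (upTo (suc n)) (expUpTo g n))
    ∷ expUpTo g n

  expEGF : (ℕ → Carrier) → ℕ → Carrier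
  expEGF g n with expUpTo g n
  ... | []    = 0#
  ... | e ∷ _ = e

  oddFact : ℕ → ℕ
  oddFact zero    = 1
  oddFact (suc n) = (2 ℕ.* n ℕ.+ 1) ℕ.* oddFact n

  -- 1/√(1-2tx) = Σₙ C(2n,n) (2tx/4)ⁿ  (binomial series);
  -- as an EGF its n-th coefficient is n!·C(2n,n)·tⁿ/2ⁿ = (2n-1)!! tⁿ.
  invSqrt1m2tx : Carrier → ℕ → Carrier
  invSqrt1m2tx t n = oddFact n ·ℕ (t ^ n)

  -- the EGF of (r-t)x + (s-t²)x²  (coefficient of x²/2! is 2(s-t²))
  exponent : Carrier → Carrier → Carrier → ℕ → Carrier
  exponent r s t 1 = r - t
  exponent r s t 2 = 2 ·ℕ (s - t * t)
  exponent r s t _ = 0#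

  rhsCoeff : Carrier → Carrier → Carrier → ℕ → Carrier
  rhsCoeff r s t = expEGF (exponent r s t) ⊛ invSqrt1m2tx t

  lhsCoeff : Carrier → Carrier → Carrier → ℕ → Carrier
  lhsCoeff r s t n = sumR (map (λ M → (r ^ cM M) * ((s ^ pM M) * (t ^ daM M))) (matchings n))

{-# OPTIONS --safe #-}
module Submission where

-- Decompose a perfect matching N of {0, …, m+1} by the partner x of 0: conjugating N by the
-- transposition of x and m+1 makes {0, m+1} a centered arc, and deleting that arc leaves a
-- matching M of the m inner points.  For x = m+1 this multiplies the weight by r.  Otherwise the
-- arc {a, b} of M at a = x - 1 is replaced by {0, a} and {b, m+1}: if {a, b} was centered, a
-- factor r becomes s; if it was coupled, its mirror arc becomes asymmetric too and s becomes t³;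
-- if it was asymmetric, t becomes t².  An involution exchanging a with 0 and commuting with the
-- mirror shows that the resulting sums over M do not depend on a, so Aₙ = Σ_{M ∈ 𝓜ₙ} r^c s^p t^da
-- satisfies
--   A(n+2) = r A(n+1) + (2n+2) (s Aₙ + t Hₙ),   H(n+1) = (2n+2) (t² Aₙ + t Hₙ),
-- where Hₙ is the analogous sum over 𝓜ₙ₊₁ with the arcs at 0 and at its mirror point counted as
-- asymmetric (leaving out the matchings in which the arc at 0 is centered).  On the other side
-- E = exp ((r-t) x + (s-t²) x²) and h = (1 - 2tx)^(-1/2) satisfy E′ = ((r-t) + 2(s-t²) x) E and
-- h′ = t h + 2t x h′, so ρ = E h and η = E h′ - t ρ obey the same recurrences with the same
-- initial values.

open import Defs
open import Data.Nat using (ℕ)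
open import Algebra.Bundles using (CommutativeRing)
open import Algebra.Bundles using (Semiring)
open import Data.Nat using (suc)
open import Data.Fin using (Fin; opposite)
open import Relation.Binary.PropositionalEquality using (_≢_)

module Counting where

  open import Data.Bool using (Bool; true; false; if_then_else_)
  open import Data.Nat using (ℕ; zero; suc; _+_; _*_)
  open import Data.Nat.Properties using (+-*-semiring; +-comm; *-identityˡ)
  open import Data.Fin using (Fin)
  open import Data.Fin.Properties using (_≟_)
  open import Data.List using (List; []; _∷_; length; filter; tabulate)
  import Data.List.Membership.DecPropositional as DecMembership
  import Data.List.Relation.Unary.All.Properties as All
  open import Data.List.Relation.Unary.All using (All; []; _∷_)
  open import Data.List.Relation.Unary.Unique.Propositional using (Unique)
  open import Data.List.Relation.Unary.AllPairs using (_∷_)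
  open import Data.Fin.Permutation using (permutation)
  open import Function using (_∘_)
  open import Algebra.Definitions using (Involutive)
  open import Relation.Nullary using (Dec; yes; no; does)
  open import Relation.Nullary.Decidable using (dec-false)
  open import Relation.Binary.PropositionalEquality using (_≡_; refl; sym; trans; cong; cong₂; module ≡-Reasoning)
  open import Algebra.Properties.Semiring.Sum +-*-semiring
    using (sum; sum-cong-≗; ∑-distrib-+; ∑-permute; *-distribʳ-sum; sum-replicate-zero)

  module _ {k : ℕ} where
    open DecMembership (_≟_ {k}) public using (_∈_; _∉_; _∈?_)

  [_] : Bool → ℕ
  [ b ] = if b then 1 else 0

  count : ∀ {k} → (Fin k → Bool) → ℕ
  count P = sum (λ i → [ P i ])

  length-filter-tabulate : ∀ {a} {A : Set a} {P : A → Set} (P? : ∀ x → Dec (P x)) {k} (f : Fin k → A) →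
    length (filter P? (tabulate f)) ≡ count (λ i → does (P? (f i)))
  length-filter-tabulate P? {zero} f = refl
  length-filter-tabulate P? {suc k} f with does (P? (f Fin.zero))
  ... | true  = cong suc (length-filter-tabulate P? (f ∘ Fin.suc))
  ... | false = length-filter-tabulate P? (f ∘ Fin.suc)

  sum-involution : ∀ {k} (σ : Fin k → Fin k) → Involutive _≡_ σ → (g : Fin k → ℕ) → sum g ≡ sum (g ∘ σ)
  sum-involution σ σ-involutive g = ∑-permute g (permutation σ σ σ-involutive σ-involutive)

  count-≟ : ∀ {k} (x : Fin k) → count (λ j → does (j ≟ x)) ≡ 1
  count-≟ {suc k} Fin.zero = cong suc (sum-replicate-zero k)
  count-≟ (Fin.suc x) = count-≟ x

  count-∈ : ∀ {k} (xs : List (Fin k)) → Unique xs → count (λ j → does (j ∈? xs)) ≡ length xs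
  count-∈ {k} [] _ = sum-replicate-zero k
  count-∈ {k} (x ∷ xs) (x∉xs ∷ xs-unique) = begin
    count (λ j → does (j ∈? (x ∷ xs)))
      ≡⟨ sum-cong-≗ split ⟩
    sum (λ j → [ does (j ≟ x) ] + [ does (j ∈? xs) ])
      ≡⟨ ∑-distrib-+ (λ j → [ does (j ≟ x) ]) (λ j → [ does (j ∈? xs) ]) ⟩
    count (λ j → does (j ≟ x)) + count (λ j → does (j ∈? xs))
      ≡⟨ cong₂ _+_ (count-≟ x) (count-∈ xs xs-unique) ⟩
    suc (length xs) ∎
    where
    open ≡-Reasoning
    split : ∀ (j : Fin k) → [ does (j ∈? (x ∷ xs)) ] ≡ [ does (j ≟ x) ] + [ does (j ∈? xs) ]
    split j with j ≟ x
    ... | yes refl rewrite dec-false (j ∈? xs) (All.All¬⇒¬Any x∉xs) = refl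
    ... | no _ = refl

  sum-agree-outside : ∀ {k} (xs : List (Fin k)) {g h : Fin k → ℕ} {c d : ℕ} →
    (∀ j → j ∉ xs → g j ≡ h j) → (∀ {j} → j ∈ xs → g j ≡ c) → (∀ {j} → j ∈ xs → h j ≡ d) →
    sum g + count (λ j → does (j ∈? xs)) * d ≡ sum h + count (λ j → does (j ∈? xs)) * c
  sum-agree-outside {k} xs {g} {h} {c} {d} off onᵍ onʰ = begin
    sum g + count P * d                        ≡⟨ cong (sum g +_) (*-distribʳ-sum d (λ j → [ P j ])) ⟩
    sum g + sum (λ j → [ P j ] * d)            ≡⟨ ∑-distrib-+ g (λ j → [ P j ] * d) ⟨
    sum (λ j → g j + [ P j ] * d)              ≡⟨ sum-cong-≗ pointwise ⟩
    sum (λ j → h j + [ P j ] * c)              ≡⟨ ∑-distrib-+ h (λ j → [ P j ] * c) ⟩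
    sum h + sum (λ j → [ P j ] * c)            ≡⟨ cong (sum h +_) (*-distribʳ-sum c (λ j → [ P j ])) ⟨
    sum h + count P * c                        ∎
    where
    open ≡-Reasoning
    P : Fin k → Bool
    P j = does (j ∈? xs)
    pointwise : ∀ (j : Fin k) → g j + [ P j ] * d ≡ h j + [ P j ] * c
    pointwise j with j ∈? xs
    ... | no j∉xs  = cong (_+ 0) (off j j∉xs)
    ... | yes j∈xs rewrite onᵍ j∈xs | onʰ j∈xs =
      trans (+-comm c (1 * d)) (cong₂ _+_ (*-identityˡ d) (sym (*-identityˡ c)))

module OuterPoints where

  open import Data.Nat using (ℕ; zero; suc; _+_; _*_)
  open import Data.Nat.Properties using (+-suc)
  open import Data.Fin using (Fin; zero; suc; fromℕ; inject₁; opposite)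
  open import Data.Fin.Properties using (suc-injective; inject₁-injective; fromℕ≢inject₁; opposite-involutive)
  import Data.Fin.Relation.Unary.Top as Top
  open import Function using (_∘_)
  open import Relation.Binary.PropositionalEquality using (_≡_; _≢_; refl; sym; trans; cong; subst)

  private
    variable
      k m : ℕ

  opposite-inject₁ : (j : Fin (suc m)) → opposite (inject₁ j) ≡ suc (opposite j)
  opposite-inject₁ zero    = refl
  opposite-inject₁ {suc m} (suc j) = cong inject₁ (opposite-inject₁ j)

  opposite-injective : {i j : Fin k} → opposite i ≡ opposite j → i ≡ j
  opposite-injective {i = i} {j} e = trans (sym (opposite-involutive i)) (trans (cong opposite e) (opposite-involutive j))

  opposite-swap : {i j : Fin k} → opposite i ≡ j → i ≡ opposite j
  opposite-swap {i = i} e = trans (sym (opposite-involutive i)) (cong opposite e)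

  top : Fin (suc (suc m))
  top = fromℕ _

  inner : Fin m → Fin (suc (suc m))
  inner j = suc (inject₁ j)

  opposite-top : opposite (top {m}) ≡ zero
  opposite-top = opposite-involutive zero

  opposite-inner : (j : Fin m) → opposite (inner j) ≡ inner (opposite j)
  opposite-inner {suc m} j = cong inject₁ (opposite-inject₁ j)

  inner-injective : {i j : Fin m} → inner i ≡ inner j → i ≡ j
  inner-injective = inject₁-injective ∘ suc-injective

  inner≢zero : {j : Fin m} → inner j ≢ zero
  inner≢zero ()

  inner≢top : {j : Fin m} → inner j ≢ top
  inner≢top e = fromℕ≢inject₁ (sym (suc-injective e))

  zero≢top : zero ≢ top {m}
  zero≢top ()

  point-elim : {P : Fin (suc (suc m)) → Set} → P zero → P top → (∀ j → P (inner j)) → ∀ x → P x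
  point-elim p₀ pₜ pᵢ zero = p₀
  point-elim p₀ pₜ pᵢ (suc y) with Top.view y
  ... | Top.‵fromℕ     = pₜ
  ... | Top.‵inject₁ j = pᵢ j

  opposite-fixpoint-free-suc-suc : (∀ (i : Fin m) → opposite i ≢ i) → ∀ (x : Fin (suc (suc m))) → opposite x ≢ x
  opposite-fixpoint-free-suc-suc fixpoint-free = point-elim
    (zero≢top ∘ sym)
    (λ e → zero≢top (trans (sym opposite-top) e))
    (λ j e → fixpoint-free j (inner-injective (trans (sym (opposite-inner j)) e)))

  twice-suc : ∀ n → 2 * suc n ≡ suc (suc (2 * n))
  twice-suc n = cong suc (+-suc n (n + 0))

  opposite-fixpoint-free-even : ∀ n (i : Fin (2 * n)) → opposite i ≢ i
  opposite-fixpoint-free-even zero    ()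
  opposite-fixpoint-free-even (suc n) = subst (λ k → ∀ (i : Fin k) → opposite i ≢ i) (sym (twice-suc n))
    (opposite-fixpoint-free-suc-suc (opposite-fixpoint-free-even n))

module Matchings where

  open OuterPoints
  open import Data.Nat using (ℕ; zero; suc)
  open import Data.Fin using (Fin; zero; suc)
  open import Data.Fin.Properties using (_≟_)
  import Data.Fin.Relation.Unary.Top as Top
  open import Data.Fin.Permutation.Components using (transpose)
  open import Data.Empty using (⊥-elim)
  open import Algebra.Definitions using (Involutive)
  open import Function using (_∘_)
  open import Relation.Nullary using (Dec; yes; no)
  open import Relation.Nullary.Decidable using (dec-true; dec-false)
  open import Relation.Binary.PropositionalEquality using (_≡_; _≢_; _≗_; refl; sym; trans; cong; module ≡-Reasoning)

  private
    variable
      k m : ℕ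

  record IsMatching (f : Fin k → Fin k) : Set where
    field
      fixpoint-free : ∀ i → f i ≢ i
      involutive    : Involutive _≡_ f

  open IsMatching public

  matching-cong : {f g : Fin k → Fin k} → f ≗ g → IsMatching f → IsMatching g
  matching-cong {f = f} {g} f≗g f-matching = record
    { fixpoint-free = λ i gi≡i → fixpoint-free f-matching i (trans (f≗g i) gi≡i)
    ; involutive    = λ i → trans (cong g (sym (f≗g i))) (trans (sym (f≗g (f i))) (involutive f-matching i))
    }

  conj : (Fin k → Fin k) → (Fin k → Fin k) → Fin k → Fin k
  conj σ f = σ ∘ f ∘ σ

  module _ (σ : Fin k → Fin k) (σ-involutive : Involutive _≡_ σ) where

    involution-injective : ∀ {i j} → σ i ≡ σ j → i ≡ j
    involution-injective {i} {j} e = trans (sym (σ-involutive i)) (trans (cong σ e) (σ-involutive j))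

    conj-matching : {f : Fin k → Fin k} → IsMatching f → IsMatching (conj σ f)
    conj-matching {f} f-matching = record
      { fixpoint-free = λ i e → fixpoint-free f-matching (σ i)
          (involution-injective (trans e (sym (σ-involutive i))))
      ; involutive    = λ i → trans (cong (σ ∘ f) (σ-involutive (f (σ i))))
          (trans (cong σ (involutive f-matching (σ i))) (σ-involutive i))
      }

    conj-conj : (f : Fin k → Fin k) → conj σ (conj σ f) ≗ f
    conj-conj f i = trans (cong (σ ∘ σ ∘ f) (σ-involutive i)) (σ-involutive (f i))

  matching-injective : {f : Fin k → Fin k} → IsMatching f → ∀ {i j} → f i ≡ f j → i ≡ j
  matching-injective {f = f} f-matching = involution-injective f (involutive f-matching)

  module _ (i j : Fin k) where

    transpose-left : transpose i j i ≡ j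
    transpose-left rewrite dec-true (i ≟ i) refl = refl

    transpose-right : transpose i j j ≡ i
    transpose-right with j ≟ i
    ... | yes j≡i = j≡i
    ... | no _ rewrite dec-true (j ≟ j) refl = refl

    transpose-other : ∀ {l} → l ≢ i → l ≢ j → transpose i j l ≡ l
    transpose-other {l} l≢i l≢j rewrite dec-false (l ≟ i) l≢i | dec-false (l ≟ j) l≢j = refl

    transpose-involutive : Involutive _≡_ (transpose i j)
    transpose-involutive l = by-cases (l ≟ i) (l ≟ j)
      where
      by-cases : Dec (l ≡ i) → Dec (l ≡ j) → transpose i j (transpose i j l) ≡ l
      by-cases (yes refl) _          = trans (cong (transpose i j) transpose-left) transpose-right
      by-cases (no _)     (yes refl) = trans (cong (transpose i j) transpose-right) transpose-left
      by-cases (no l≢i)   (no l≢j)   = trans (cong (transpose i j) (transpose-other l≢i l≢j)) (transpose-other l≢i l≢j)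

  transpose-self : (i : Fin k) → transpose i i ≗ (λ l → l)
  transpose-self i l with l ≟ i
  ... | yes l≡i = sym l≡i
  ... | no l≢i rewrite dec-false (l ≟ i) l≢i = refl

  enclose : (Fin m → Fin m) → Fin (suc (suc m)) → Fin (suc (suc m))
  enclose M zero = top
  enclose M (suc y) with Top.view y
  ... | Top.‵fromℕ     = zero
  ... | Top.‵inject₁ j = inner (M j)

  enclose-top : (M : Fin m → Fin m) → enclose M top ≡ zero
  enclose-top {m} M rewrite Top.view-fromℕ m = refl

  enclose-inner : (M : Fin m → Fin m) (j : Fin m) → enclose M (inner j) ≡ inner (M j)
  enclose-inner M j rewrite Top.view-inject₁ j = refl

  enclose-cong : {M M′ : Fin m → Fin m} → M ≗ M′ → enclose M ≗ enclose M′
  enclose-cong {M = M} {M′} M≗M′ = point-elim refl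
    (trans (enclose-top M) (sym (enclose-top M′)))
    (λ j → trans (enclose-inner M j) (trans (cong inner (M≗M′ j)) (sym (enclose-inner M′ j))))

  enclose-matching : {M : Fin m → Fin m} → IsMatching M → IsMatching (enclose M)
  enclose-matching {M = M} M-matching = record
    { fixpoint-free = point-elim
        (λ e → zero≢top (sym e))
        (λ e → zero≢top (trans (sym (enclose-top M)) e))
        (λ j e → fixpoint-free M-matching j (inner-injective (trans (sym (enclose-inner M j)) e)))
    ; involutive = point-elim
        (enclose-top M)
        (cong (enclose M) (enclose-top M))
        (λ j → trans (cong (enclose M) (enclose-inner M j))
                     (trans (enclose-inner M (M j)) (cong inner (involutive M-matching j))))
    }

  innerOr : Fin m → Fin (suc (suc m)) → Fin m
  innerOr d zero = d
  innerOr d (suc y) with Top.view y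
  ... | Top.‵fromℕ     = d
  ... | Top.‵inject₁ j = j

  innerOr-inner : (d j : Fin m) → innerOr d (inner j) ≡ j
  innerOr-inner d j rewrite Top.view-inject₁ j = refl

  inner-innerOr : (d : Fin m) {x : Fin (suc (suc m))} → x ≢ zero → x ≢ top → inner (innerOr d x) ≡ x
  inner-innerOr d {zero} x≢0 _ = ⊥-elim (x≢0 refl)
  inner-innerOr d {suc y} _ x≢top with Top.view y
  ... | Top.‵fromℕ     = ⊥-elim (x≢top refl)
  ... | Top.‵inject₁ j = refl

  restrict : (Fin (suc (suc m)) → Fin (suc (suc m))) → Fin m → Fin m
  restrict N j = innerOr j (N (inner j))

  restrict-cong : {N N′ : Fin (suc (suc m)) → Fin (suc (suc m))} → N ≗ N′ → restrict N ≗ restrict N′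
  restrict-cong N≗N′ j = cong (innerOr j) (N≗N′ (inner j))

  restrict-enclose : (M : Fin m → Fin m) → restrict (enclose M) ≗ M
  restrict-enclose M j = trans (cong (innerOr j) (enclose-inner M j)) (innerOr-inner j (M j))

  module _ {N : Fin (suc (suc m)) → Fin (suc (suc m))} (N-matching : IsMatching N) (N0≡top : N zero ≡ top) where

    private
      N-involutive : Involutive _≡_ N
      N-involutive = involutive N-matching

    inner-restrict : (j : Fin m) → inner (restrict N j) ≡ N (inner j)
    inner-restrict j = inner-innerOr j
      (λ e → inner≢top (trans (sym (N-involutive (inner j))) (trans (cong N e) N0≡top)))
      (λ e → inner≢zero (matching-injective N-matching (trans e (sym N0≡top))))

    enclose-restrict : enclose (restrict N) ≗ N
    enclose-restrict = point-elim (sym N0≡top)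
      (trans (enclose-top (restrict N)) (trans (sym (N-involutive zero)) (cong N N0≡top)))
      (λ j → trans (enclose-inner (restrict N) j) (inner-restrict j))

    restrict-matching : IsMatching (restrict N)
    restrict-matching = record
      { fixpoint-free = λ j e → fixpoint-free N-matching (inner j) (trans (sym (inner-restrict j)) (cong inner e))
      ; involutive    = λ j → inner-injective (trans (inner-restrict (restrict N j))
          (trans (cong N (inner-restrict j)) (N-involutive (inner j))))
      }

  -- 0 is matched with x: conjugating by the transposition of top and x moves the outer arc {0, top}
  -- of enclose M to {0, x}, and the arc of enclose M through x to top.
  extend : Fin (suc (suc m)) → (Fin m → Fin m) → Fin (suc (suc m)) → Fin (suc (suc m))
  extend x M = conj (transpose top x) (enclose M)

  retract : (Fin (suc (suc m)) → Fin (suc (suc m))) → Fin m → Fin m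
  retract N = restrict (conj (transpose top (N zero)) N)

  module _ (x : Fin (suc (suc m))) where

    private
      τ : Fin (suc (suc m)) → Fin (suc (suc m))
      τ = transpose top x
      τ-involutive : Involutive _≡_ τ
      τ-involutive = transpose-involutive top x

    extend-matching : {M : Fin m → Fin m} → IsMatching M → IsMatching (extend x M)
    extend-matching M-matching = conj-matching τ τ-involutive (enclose-matching M-matching)

    extend-zero : (M : Fin m → Fin m) → x ≢ zero → extend x M zero ≡ x
    extend-zero M x≢0 = trans (cong (τ ∘ enclose M) (transpose-other top x zero≢top (λ e → x≢0 (sym e))))
                              (transpose-left top x)

    retract-extend : {M : Fin m → Fin m} → x ≢ zero → retract (extend x M) ≗ M
    retract-extend {M} x≢0 j = begin
      retract (extend x M) j
        ≡⟨ cong (λ y → restrict (conj (transpose top y) (extend x M)) j) (extend-zero M x≢0) ⟩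
      restrict (conj τ (conj τ (enclose M))) j
        ≡⟨ restrict-cong (conj-conj τ τ-involutive (enclose M)) j ⟩
      restrict (enclose M) j
        ≡⟨ restrict-enclose M j ⟩
      M j ∎
      where open ≡-Reasoning

  extend-top : (M : Fin m → Fin m) → extend top M ≗ enclose M
  extend-top M l = trans (transpose-self top _) (cong (enclose M) (transpose-self top l))

  module _ {N : Fin (suc (suc m)) → Fin (suc (suc m))} (N-matching : IsMatching N) where

    private
      τ : Fin (suc (suc m)) → Fin (suc (suc m))
      τ = transpose top (N zero)
      τ-involutive : Involutive _≡_ τ
      τ-involutive = transpose-involutive top (N zero)
      N′-matching : IsMatching (conj τ N)
      N′-matching = conj-matching τ τ-involutive N-matching
      N′0≡top : conj τ N zero ≡ top
      N′0≡top = trans (cong (τ ∘ N) (transpose-other top (N zero) zero≢top (fixpoint-free N-matching zero ∘ sym)))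
                      (transpose-right top (N zero))

    retract-matching : IsMatching (retract N)
    retract-matching = restrict-matching N′-matching N′0≡top

    extend-retract : extend (N zero) (retract N) ≗ N
    extend-retract l = begin
      τ (enclose (retract N) (τ l)) ≡⟨ cong τ (enclose-restrict N′-matching N′0≡top (τ l)) ⟩
      τ (conj τ N (τ l))            ≡⟨ conj-conj τ τ-involutive N l ⟩
      N l                           ∎
      where open ≡-Reasoning

  extend-cong : (x : Fin (suc (suc m))) {M M′ : Fin m → Fin m} → M ≗ M′ → extend x M ≗ extend x M′
  extend-cong x M≗M′ y = cong (transpose top x) (enclose-cong M≗M′ (transpose top x y))

  retract-cong : {N N′ : Fin (suc (suc m)) → Fin (suc (suc m))} → N ≗ N′ → retract N ≗ retract N′
  retract-cong {N = N} {N′} N≗N′ j rewrite N≗N′ zero =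
    restrict-cong (λ y → cong (transpose top (N′ zero)) (N≗N′ (transpose top (N′ zero) y))) j

module ArcKinds where

  open Counting
  open OuterPoints
  open Matchings
  open import Data.Bool using (Bool; true; false; _∧_; not)
  open import Data.Nat as ℕ using (ℕ; _+_; _*_)
  open import Data.Nat.Properties using (<-cmp; +-identityʳ; +-*-semiring)
  open import Data.Fin using (Fin; toℕ; opposite)
  open import Data.Fin.Properties using (_≟_; toℕ-injective; opposite-involutive)
  open import Data.Vec using (Vec; lookup)
  open import Algebra.Definitions using (Involutive)
  open import Function using (_∘_; case_of_)
  open import Function.Bundles using (mk⇔)
  open import Relation.Binary.Definitions using (tri<; tri≈; tri>)
  open import Relation.Nullary using (Dec; yes; no; does)
  open import Relation.Nullary.Decidable using (dec-true; dec-false; does-⇔)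
  open import Relation.Binary.PropositionalEquality using (_≡_; _≢_; _≗_; refl; sym; trans; cong; cong₂; module ≡-Reasoning)
  open import Algebra.Properties.Semiring.Sum +-*-semiring using (sum; sum-cong-≗; ∑-distrib-+)
  open import Data.Empty using (⊥-elim)
  open import Data.Product using (proj₁; proj₂)

  private
    variable
      k : ℕ

  data ArcKind : Set where
    centered coupled asymmetric : ArcKind

  _==_ : ArcKind → ArcKind → Bool
  centered   == centered   = true
  coupled    == coupled    = true
  asymmetric == asymmetric = true
  _          == _          = false

  kindOf : Bool → Bool → ArcKind
  kindOf true  _     = centered
  kindOf false true  = coupled
  kindOf false false = asymmetric

  isCentered : (Fin k → Fin k) → Fin k → Bool
  isCentered f x = does (f x ≟ opposite x)

  hasMirrorArc : (Fin k → Fin k) → Fin k → Bool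
  hasMirrorArc f x = does (f (opposite x) ≟ opposite (f x))

  kind : (Fin k → Fin k) → Fin k → ArcKind
  kind f x = kindOf (isCentered f x) (hasMirrorArc f x)

  pointsOf : (Fin k → Fin k) → ArcKind → ℕ
  pointsOf f κ = count (λ x → kind f x == κ)

  kind-cong : {f g : Fin k → Fin k} → f ≗ g → ∀ x → kind f x ≡ kind g x
  kind-cong f≗g x rewrite f≗g x | f≗g (opposite x) = refl

  pointsOf-cong : {f g : Fin k → Fin k} → f ≗ g → ∀ κ → pointsOf f κ ≡ pointsOf g κ
  pointsOf-cong f≗g κ = sum-cong-≗ (λ x → cong (λ κ′ → [ κ′ == κ ]) (kind-cong f≗g x))

  module _ {f : Fin k → Fin k} (f-matching : IsMatching f) where

    private
      f-inv : Involutive _≡_ f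
      f-inv = involutive f-matching
      f-swap : ∀ {i j} → f i ≡ j → i ≡ f j
      f-swap e = trans (sym (f-inv _)) (cong f e)

    isCentered-involution : ∀ x → isCentered f (f x) ≡ isCentered f x
    isCentered-involution x = does-⇔
      (mk⇔ (λ e → opposite-swap (sym (trans (sym (f-inv x)) e)))
           (λ e → trans (f-inv x) (opposite-swap (sym e))))
      (f (f x) ≟ opposite (f x)) (f x ≟ opposite x)

    hasMirrorArc-involution : ∀ x → hasMirrorArc f (f x) ≡ hasMirrorArc f x
    hasMirrorArc-involution x = does-⇔
      (mk⇔ (λ e → sym (f-swap (trans e (cong opposite (f-inv x)))))
           (λ e → trans (sym (f-swap e)) (cong opposite (sym (f-inv x)))))
      (f (opposite (f x)) ≟ opposite (f (f x))) (f (opposite x) ≟ opposite (f x))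

    isCentered-opposite : ∀ x → isCentered f (opposite x) ≡ isCentered f x
    isCentered-opposite x = does-⇔
      (mk⇔ (λ e → sym (f-swap (trans e (opposite-involutive x))))
           (λ e → trans (sym (f-swap e)) (sym (opposite-involutive x))))
      (f (opposite x) ≟ opposite (opposite x)) (f x ≟ opposite x)

    hasMirrorArc-opposite : ∀ x → hasMirrorArc f (opposite x) ≡ hasMirrorArc f x
    hasMirrorArc-opposite x = does-⇔
      (mk⇔ (λ e → opposite-swap (sym (trans (cong f (sym (opposite-involutive x))) e)))
           (λ e → trans (cong f (opposite-involutive x)) (opposite-swap (sym e))))
      (f (opposite (opposite x)) ≟ opposite (f (opposite x))) (f (opposite x) ≟ opposite (f x))

    kind-involution : ∀ x → kind f (f x) ≡ kind f x
    kind-involution x = cong₂ kindOf (isCentered-involution x) (hasMirrorArc-involution x)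

    kind-opposite : ∀ x → kind f (opposite x) ≡ kind f x
    kind-opposite x = cong₂ kindOf (isCentered-opposite x) (hasMirrorArc-opposite x)

  module _ (σ : Fin k → Fin k) (σ-involutive : Involutive _≡_ σ)
           (σ-opposite : ∀ x → σ (opposite x) ≡ opposite (σ x)) where

    isCentered-conj : (f : Fin k → Fin k) → ∀ x → isCentered (conj σ f) x ≡ isCentered f (σ x)
    isCentered-conj f x = does-⇔
      (mk⇔ (λ e → trans (sym (σ-involutive _)) (trans (cong σ e) (σ-opposite x)))
           (λ e → trans (cong σ e) (trans (σ-opposite (σ x)) (cong opposite (σ-involutive x)))))
      (σ (f (σ x)) ≟ opposite x) (f (σ x) ≟ opposite (σ x))

    hasMirrorArc-conj : (f : Fin k → Fin k) → ∀ x → hasMirrorArc (conj σ f) x ≡ hasMirrorArc f (σ x)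
    hasMirrorArc-conj f x = does-⇔
      (mk⇔ (λ e → trans (cong f (sym (σ-opposite x)))
                        (involution-injective σ σ-involutive (trans e (sym (σ-opposite (f (σ x)))))))
           (λ e → trans (cong (σ ∘ f) (σ-opposite x)) (trans (cong σ e) (σ-opposite (f (σ x))))))
      (σ (f (σ (opposite x))) ≟ opposite (σ (f (σ x)))) (f (opposite (σ x)) ≟ opposite (f (σ x)))

    kind-conj : (f : Fin k → Fin k) → ∀ x → kind (conj σ f) x ≡ kind f (σ x)
    kind-conj f x = cong₂ kindOf (isCentered-conj f x) (hasMirrorArc-conj f x)

    pointsOf-conj : (f : Fin k → Fin k) → ∀ κ → pointsOf (conj σ f) κ ≡ pointsOf f κ
    pointsOf-conj f κ = trans (sum-cong-≗ (λ x → cong (λ κ′ → [ κ′ == κ ]) (kind-conj f x)))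
                              (sym (sum-involution σ σ-involutive (λ x → [ kind f x == κ ])))

  startsArc : (Fin k → Fin k) → Fin k → Bool
  startsArc f i = does (toℕ i ℕ.<? toℕ (f i))

  module _ {f : Fin k → Fin k} (f-matching : IsMatching f) where

    startsArc-involution : ∀ i → startsArc f (f i) ≡ not (startsArc f i)
    startsArc-involution i rewrite involutive f-matching i with <-cmp (toℕ i) (toℕ (f i))
    ... | tri< i<fi _ fi≮i
      rewrite dec-true (toℕ i ℕ.<? toℕ (f i)) i<fi | dec-false (toℕ (f i) ℕ.<? toℕ i) fi≮i = refl
    ... | tri≈ _ i≡fi _ = ⊥-elim (fixpoint-free f-matching i (sym (toℕ-injective i≡fi)))
    ... | tri> i≮fi _ fi<i
      rewrite dec-false (toℕ i ℕ.<? toℕ (f i)) i≮fi | dec-true (toℕ (f i) ℕ.<? toℕ i) fi<i = refl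

    count-by-arcs : (Q : Fin k → Bool) → (∀ i → Q (f i) ≡ Q i) → count Q ≡ 2 * count (λ i → startsArc f i ∧ Q i)
    count-by-arcs Q Q-invariant = begin
      sum (λ i → [ Q i ])                    ≡⟨ sum-cong-≗ split ⟩
      sum (λ i → g i + g (f i))              ≡⟨ ∑-distrib-+ g (g ∘ f) ⟩
      sum g + sum (g ∘ f)                    ≡⟨ cong (sum g +_) (sum-involution f (involutive f-matching) g) ⟨
      sum g + sum g                          ≡⟨ cong (sum g +_) (+-identityʳ (sum g)) ⟨
      2 * sum g                              ∎
      where
      open ≡-Reasoning
      g : Fin k → ℕ
      g = λ i → [ startsArc f i ∧ Q i ]
      split : ∀ i → [ Q i ] ≡ g i + g (f i)
      split i rewrite startsArc-involution i | Q-invariant i with startsArc f i | Q i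
      ... | true  | true  = refl
      ... | true  | false = refl
      ... | false | true  = refl
      ... | false | false = refl

  kindOf-centered : ∀ a b → kindOf a b == centered ≡ a
  kindOf-centered true  _     = refl
  kindOf-centered false true  = refl
  kindOf-centered false false = refl

  kindOf-coupled : ∀ a b → kindOf a b == coupled ≡ not a ∧ b
  kindOf-coupled true  _     = refl
  kindOf-coupled false true  = refl
  kindOf-coupled false false = refl

  kindOf-asymmetric : ∀ a b → kindOf a b == asymmetric ≡ not a ∧ not b
  kindOf-asymmetric true  _     = refl
  kindOf-asymmetric false true  = refl
  kindOf-asymmetric false false = refl

  fromPerfectMatching : {v : Vec (Fin k) k} → IsPerfectMatching v → IsMatching (lookup v)
  fromPerfectMatching v-pm = record { fixpoint-free = proj₁ ∘ v-pm ; involutive = proj₂ ∘ v-pm }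

  arcsOf : Vec (Fin k) k → ArcKind → ℕ
  arcsOf v centered   = cM v
  arcsOf v coupled    = countFin (coupledArc? v)
  arcsOf v asymmetric = daM v

  module _ {v : Vec (Fin k) k} (v-pm : IsPerfectMatching v) where

    private
      f : Fin k → Fin k
      f = lookup v
      f-matching : IsMatching f
      f-matching = fromPerfectMatching {v = v} v-pm

      twice-arcs : ∀ κ {P : Fin k → Set} (P? : ∀ i → Dec (P i)) →
        (∀ i → does (P? i) ≡ startsArc f i ∧ (kind f i == κ)) → 2 * countFin P? ≡ pointsOf f κ
      twice-arcs κ P? P?-spec = sym (begin
        pointsOf f κ
          ≡⟨ count-by-arcs f-matching (λ i → kind f i == κ) (λ i → cong (_== κ) (kind-involution f-matching i)) ⟩
        2 * count (λ i → startsArc f i ∧ (kind f i == κ))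
          ≡⟨ cong (2 *_) (sum-cong-≗ (λ i → cong [_] (sym (P?-spec i)))) ⟩
        2 * count (λ i → does (P? i))
          ≡⟨ cong (2 *_) (length-filter-tabulate P? (λ i → i)) ⟨
        2 * countFin P? ∎)
        where open ≡-Reasoning

    twice-arcsOf : ∀ κ → 2 * arcsOf v κ ≡ pointsOf f κ
    twice-arcsOf centered = twice-arcs centered (centeredArc? v)
      (λ i → cong (startsArc f i ∧_) (sym (kindOf-centered (isCentered f i) (hasMirrorArc f i))))
    twice-arcsOf coupled = twice-arcs coupled (coupledArc? v)
      (λ i → cong (startsArc f i ∧_) (sym (kindOf-coupled (isCentered f i) (hasMirrorArc f i))))
    twice-arcsOf asymmetric = twice-arcs asymmetric (asymArc? v)
      (λ i → cong (startsArc f i ∧_) (sym (kindOf-asymmetric (isCentered f i) (hasMirrorArc f i))))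

  module _ {f : Fin k → Fin k} {x : Fin k} where

    centered-at : kind f x ≡ centered → f x ≡ opposite x
    centered-at e with f x ≟ opposite x
    ... | yes fx≡x′ = fx≡x′
    ... | no _ with hasMirrorArc f x
    ...   | true  = case e of λ ()
    ...   | false = case e of λ ()

    not-centered-at : kind f x ≢ centered → f x ≢ opposite x
    not-centered-at ne fx≡x′ = ne (cong (λ c → kindOf c (hasMirrorArc f x)) (dec-true (f x ≟ opposite x) fx≡x′))

module ExtensionKinds where

  open Counting
  open OuterPoints
  open Matchings
  open ArcKinds
  open import Data.Bool using (false)
  open import Data.Nat using (ℕ; zero; suc; _+_; _*_)
  open import Data.Nat.Properties using (+-*-semiring)
  open import Data.Fin using (Fin; zero; suc; opposite)
  open import Data.Fin.Properties using (_≟_; opposite-involutive)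
  open import Data.List using (List; []; _∷_; length)
  open import Data.List.Relation.Unary.Unique.Propositional using (Unique)
  open import Data.List.Relation.Unary.All using ([]; _∷_)
  open import Data.List.Relation.Unary.AllPairs using ([]; _∷_)
  open import Data.List.Relation.Unary.Any using (here; there)
  open import Data.Sum using (_⊎_; inj₁; inj₂)
  open import Function using (_∘_)
  open import Data.Fin.Permutation.Components using (transpose)
  open import Function.Bundles using (mk⇔)
  open import Relation.Nullary using (does; ¬_)
  open import Relation.Nullary.Decidable using (dec-true; dec-false; does-⇔)
  open import Relation.Binary.PropositionalEquality using (_≡_; _≢_; refl; sym; trans; cong; cong₂; module ≡-Reasoning)
  open import Data.Nat.Tactic.RingSolver using (solve-∀)
  open import Algebra.Properties.Semiring.Sum +-*-semiring using (sum; sum-cong-≗; sum-init-last)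

  private
    variable
      m : ℕ

  sum-outer-inner : (h : Fin (suc (suc m)) → ℕ) → sum h ≡ h zero + (sum (h ∘ inner) + h top)
  sum-outer-inner h = cong (h zero +_) (sum-init-last (h ∘ suc))

  inner-≟ : (u w : Fin m) → does (inner u ≟ inner w) ≡ does (u ≟ w)
  inner-≟ u w = does-⇔ (mk⇔ inner-injective (cong inner)) (inner u ≟ inner w) (u ≟ w)

  kind-at : {k : ℕ} {f : Fin k → Fin k} {x u v : Fin k} → f x ≡ u → f (opposite x) ≡ v →
    kind f x ≡ kindOf (does (u ≟ opposite x)) (does (v ≟ opposite u))
  kind-at refl refl = refl

  kind-inner : {N : Fin (suc (suc m)) → Fin (suc (suc m))} {M : Fin m → Fin m} (j : Fin m) →
    N (inner j) ≡ inner (M j) → N (inner (opposite j)) ≡ inner (M (opposite j)) → kind N (inner j) ≡ kind M j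
  kind-inner {N = N} {M} j Nj Nj′ rewrite opposite-inner j | Nj | Nj′ | opposite-inner (M j) =
    cong₂ kindOf (inner-≟ (M j) (opposite j)) (inner-≟ (M (opposite j)) (opposite (M j)))

  pointsOf-outer-inner : {N : Fin (suc (suc m)) → Fin (suc (suc m))} → IsMatching N → ∀ κ →
    pointsOf N κ ≡ 2 * [ kind N zero == κ ] + sum (λ j → [ kind N (inner j) == κ ])
  pointsOf-outer-inner {N = N} N-matching κ = begin
    pointsOf N κ
      ≡⟨ sum-outer-inner (λ x → [ kind N x == κ ]) ⟩
    [ kind N zero == κ ] + (sum (λ j → [ kind N (inner j) == κ ]) + [ kind N top == κ ])
      ≡⟨ cong (λ u → [ kind N zero == κ ] + (sum (λ j → [ kind N (inner j) == κ ]) + [ u == κ ]))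
              (kind-opposite N-matching zero) ⟩
    [ kind N zero == κ ] + (sum (λ j → [ kind N (inner j) == κ ]) + [ kind N zero == κ ])
      ≡⟨ rearrange [ kind N zero == κ ] _ ⟩
    2 * [ kind N zero == κ ] + sum (λ j → [ kind N (inner j) == κ ]) ∎
    where
    open ≡-Reasoning
    rearrange : ∀ c p → c + (p + c) ≡ 2 * c + p
    rearrange = solve-∀

  module _ {M : Fin m → Fin m} (M-matching : IsMatching M) where

    private
      E : Fin (suc (suc m)) → Fin (suc (suc m))
      E = enclose M

    kind-enclose-zero : kind E zero ≡ centered
    kind-enclose-zero = cong (λ b → kindOf b (hasMirrorArc E zero)) (dec-true (top {m} ≟ top) refl)

    pointsOf-enclose : ∀ κ → pointsOf E κ ≡ 2 * [ centered == κ ] + pointsOf M κ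
    pointsOf-enclose κ = trans (pointsOf-outer-inner (enclose-matching M-matching) κ)
      (cong₂ (λ u v → 2 * [ u == κ ] + v) kind-enclose-zero
             (sum-cong-≗ (λ j → cong (λ κ′ → [ κ′ == κ ])
               (kind-inner {N = E} {M} j (enclose-inner M j) (enclose-inner M (opposite j))))))

  module Insertion {M : Fin m → Fin m} (M-matching : IsMatching M) (a : Fin m) where

    N : Fin (suc (suc m)) → Fin (suc (suc m))
    N = extend (inner a) M

    b : Fin m
    b = M a

    N-matching : IsMatching N
    N-matching = extend-matching (inner a) M-matching

    private
      τ : Fin (suc (suc m)) → Fin (suc (suc m))
      τ = transpose top (inner a)
      b≢a : b ≢ a
      b≢a = fixpoint-free M-matching a
      τ-inner : ∀ {j} → j ≢ a → τ (inner j) ≡ inner j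
      τ-inner j≢a = transpose-other top (inner a) inner≢top (j≢a ∘ inner-injective)

    N-zero : N zero ≡ inner a
    N-zero = extend-zero (inner a) M inner≢zero

    N-top : N top ≡ inner b
    N-top = begin
      τ (enclose M (τ top))  ≡⟨ cong (τ ∘ enclose M) (transpose-left top (inner a)) ⟩
      τ (enclose M (inner a)) ≡⟨ cong τ (enclose-inner M a) ⟩
      τ (inner b)            ≡⟨ τ-inner b≢a ⟩
      inner b                ∎
      where open ≡-Reasoning

    N-inner : ∀ {j} → j ≢ a → j ≢ b → N (inner j) ≡ inner (M j)
    N-inner {j} j≢a j≢b = begin
      τ (enclose M (τ (inner j))) ≡⟨ cong (τ ∘ enclose M) (τ-inner j≢a) ⟩
      τ (enclose M (inner j))     ≡⟨ cong τ (enclose-inner M j) ⟩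
      τ (inner (M j))             ≡⟨ τ-inner (λ Mj≡a → j≢b (trans (sym (involutive M-matching j)) (cong M Mj≡a))) ⟩
      inner (M j)                 ∎
      where open ≡-Reasoning

    kind-N-zero : kind N zero ≡ kindOf false (isCentered M a)
    kind-N-zero = trans (kind-at {f = N} {x = zero} N-zero N-top)
      (cong₂ kindOf (dec-false (inner a ≟ top) inner≢top)
                    (trans (cong (λ y → does (inner b ≟ y)) (opposite-inner a)) (inner-≟ b (opposite a))))

    -- N and M differ only at the endpoints of the arc {a, b} and of its mirror image.
    Endpoint : Fin m → Set
    Endpoint j = j ≡ a ⊎ j ≡ b

    Near : Fin m → Set
    Near j = Endpoint j ⊎ Endpoint (opposite j)

    kind-M-near : ∀ {j} → Near j → kind M j ≡ kind M a
    kind-M-near (inj₁ e) = endpoint e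
      where
      endpoint : ∀ {j} → Endpoint j → kind M j ≡ kind M a
      endpoint (inj₁ refl) = refl
      endpoint (inj₂ refl) = kind-involution M-matching a
    kind-M-near {j} (inj₂ e) = trans (sym (kind-opposite M-matching j)) (kind-M-near (inj₁ e))

    kind-N-near : ∀ {j} → Near j → kind N (inner j) ≡ kind N zero
    kind-N-near (inj₁ e) = endpoint e
      where
      endpoint : ∀ {j} → Endpoint j → kind N (inner j) ≡ kind N zero
      endpoint (inj₁ refl) = trans (cong (kind N) (sym N-zero)) (kind-involution N-matching zero)
      endpoint (inj₂ refl) = trans (cong (kind N) (sym N-top))
                                   (trans (kind-involution N-matching top) (kind-opposite N-matching zero))
    kind-N-near {j} (inj₂ e) = begin
      kind N (inner j)                       ≡⟨ kind-opposite N-matching (inner j) ⟨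
      kind N (opposite (inner j))            ≡⟨ cong (kind N) (opposite-inner j) ⟩
      kind N (inner (opposite j))            ≡⟨ kind-N-near (inj₁ e) ⟩
      kind N zero                            ∎
      where open ≡-Reasoning

    kind-N-far : ∀ {j} → ¬ Near j → kind N (inner j) ≡ kind M j
    kind-N-far {j} far = kind-inner {N = N} {M} j
      (N-inner (λ e → far (inj₁ (inj₁ e))) (λ e → far (inj₁ (inj₂ e))))
      (N-inner (λ e → far (inj₂ (inj₁ e))) (λ e → far (inj₂ (inj₂ e))))

    pointsOf-insert : (T : List (Fin m)) → Unique T → (∀ {j} → j ∈ T → Near j) → (∀ {j} → Near j → j ∈ T) →
      (h : ℕ) → length T ≡ 2 * h → ∀ κ →
      pointsOf N κ + 2 * (h * [ kind M a == κ ]) ≡ pointsOf M κ + 2 * ((1 + h) * [ kind N zero == κ ])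
    pointsOf-insert T T-unique T-near near-T h |T|≡2h κ = begin
      pointsOf N κ + 2 * (h * d)            ≡⟨ cong (_+ 2 * (h * d)) (pointsOf-outer-inner N-matching κ) ⟩
      (2 * c + sum g) + 2 * (h * d)         ≡⟨ regroup c (sum g) h d ⟩
      2 * c + (sum g + (2 * h) * d)         ≡⟨ cong (λ C → 2 * c + (sum g + C * d)) C≡2h ⟨
      2 * c + (sum g + C * d)               ≡⟨ cong (2 * c +_) (sum-agree-outside T
                                                 (λ j j∉T → at-κ (kind-N-far (j∉T ∘ near-T)))
                                                 (at-κ ∘ kind-N-near ∘ T-near)
                                                 (at-κ ∘ kind-M-near ∘ T-near)) ⟩
      2 * c + (pointsOf M κ + C * c)        ≡⟨ cong (λ C → 2 * c + (pointsOf M κ + C * c)) C≡2h ⟩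
      2 * c + (pointsOf M κ + (2 * h) * c)  ≡⟨ collect c (pointsOf M κ) h ⟩
      pointsOf M κ + 2 * ((1 + h) * c)      ∎
      where
      open ≡-Reasoning
      C : ℕ
      C = count (λ j → does (j ∈? T))
      C≡2h : C ≡ 2 * h
      C≡2h = trans (count-∈ T T-unique) |T|≡2h
      c : ℕ
      c = [ kind N zero == κ ]
      d : ℕ
      d = [ kind M a == κ ]
      g : Fin m → ℕ
      g j = [ kind N (inner j) == κ ]
      at-κ : ∀ {κ₁ κ₂} → κ₁ ≡ κ₂ → [ κ₁ == κ ] ≡ [ κ₂ == κ ]
      at-κ = cong (λ κ′ → [ κ′ == κ ])
      regroup : ∀ c G h d → (2 * c + G) + 2 * (h * d) ≡ 2 * c + (G + (2 * h) * d)
      regroup = solve-∀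
      collect : ∀ c P h → 2 * c + (P + (2 * h) * c) ≡ P + 2 * ((1 + h) * c)
      collect = solve-∀

    module _ (a-centered : b ≡ opposite a) where

      private
        T : List (Fin m)
        T = a ∷ b ∷ []

      pointsOf-insert-centered : ∀ κ →
        pointsOf N κ + 2 * (1 * [ kind M a == κ ]) ≡ pointsOf M κ + 2 * (2 * [ kind N zero == κ ])
      pointsOf-insert-centered = pointsOf-insert T ((b≢a ∘ sym ∷ []) ∷ [] ∷ []) T-near near-T 1 refl
        where
        T-near : ∀ {j} → j ∈ T → Near j
        T-near (here j≡a)         = inj₁ (inj₁ j≡a)
        T-near (there (here j≡b)) = inj₁ (inj₂ j≡b)
        T-near (there (there ()))
        near-T : ∀ {j} → Near j → j ∈ T
        near-T (inj₁ (inj₁ j≡a)) = here j≡a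
        near-T (inj₁ (inj₂ j≡b)) = there (here j≡b)
        near-T (inj₂ (inj₁ j′≡a)) = there (here (trans (opposite-swap j′≡a) (sym a-centered)))
        near-T (inj₂ (inj₂ j′≡b)) = here (trans (opposite-swap (trans j′≡b a-centered)) (opposite-involutive a))

    module _ (opposite-fixpoint-free : ∀ (i : Fin m) → opposite i ≢ i) (a-not-centered : b ≢ opposite a) where

      private
        T : List (Fin m)
        T = a ∷ b ∷ opposite a ∷ opposite b ∷ []

      pointsOf-insert-not-centered : ∀ κ →
        pointsOf N κ + 2 * (2 * [ kind M a == κ ]) ≡ pointsOf M κ + 2 * (3 * [ kind N zero == κ ])
      pointsOf-insert-not-centered = pointsOf-insert T T-unique T-near near-T 2 refl
        where
        T-unique : Unique T
        T-unique = (b≢a ∘ sym ∷ (λ e → opposite-fixpoint-free a (sym e))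
                              ∷ (λ e → a-not-centered (opposite-swap (sym e))) ∷ [])
                 ∷ (a-not-centered ∷ (λ e → opposite-fixpoint-free b (sym e)) ∷ [])
                 ∷ ((λ e → b≢a (sym (opposite-injective e))) ∷ [])
                 ∷ [] ∷ []
        T-near : ∀ {j} → j ∈ T → Near j
        T-near (here j≡a)                         = inj₁ (inj₁ j≡a)
        T-near (there (here j≡b))                 = inj₁ (inj₂ j≡b)
        T-near (there (there (here refl)))        = inj₂ (inj₁ (opposite-involutive a))
        T-near (there (there (there (here refl)))) = inj₂ (inj₂ (opposite-involutive b))
        T-near (there (there (there (there ()))))
        near-T : ∀ {j} → Near j → j ∈ T
        near-T (inj₁ (inj₁ j≡a)) = here j≡a
        near-T (inj₁ (inj₂ j≡b)) = there (here j≡b)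
        near-T (inj₂ (inj₁ j′≡a)) = there (there (here (opposite-swap j′≡a)))
        near-T (inj₂ (inj₂ j′≡b)) = there (there (there (here (opposite-swap j′≡b))))

module ArcCounts where

  open Counting
  open OuterPoints
  open Matchings
  open ArcKinds
  open ExtensionKinds
  open import Data.Bool using (false)
  open import Data.Nat using (ℕ; zero; suc; _+_; _*_; s≤s; z≤n)
  open import Data.Nat.Properties using (*-cancelˡ-≡; +-cancelʳ-≡; *-distribˡ-+; +-identityʳ; +-comm; +-suc)
  open import Data.Nat.DivMod using (_/_; m/n≡1+[m∸n]/n)
  open import Data.Fin using (Fin; zero; suc; opposite)
  open import Data.Vec using (Vec; lookup; tabulate)
  open import Data.Vec.Properties using (lookup∘tabulate)
  open import Data.Product using (_,_)
  open import Function using (_∘_)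
  open import Relation.Binary.PropositionalEquality using (_≡_; _≢_; sym; trans; cong; subst₂; module ≡-Reasoning)
  open import Relation.Nullary.Decidable using (dec-true; dec-false)
  open import Data.Fin.Properties using (_≟_)

  private
    variable
      k m : ℕ

  SelfMap : ℕ → Set
  SelfMap k = Vec (Fin k) k

  toPerfectMatching : {f : Fin k → Fin k} → IsMatching f → IsPerfectMatching (tabulate f)
  toPerfectMatching {f = f} f-matching i = fixpoint-free f′-matching i , involutive f′-matching i
    where
    f′-matching : IsMatching (lookup (tabulate f))
    f′-matching = matching-cong (sym ∘ lookup∘tabulate f) f-matching

  halve : ∀ {x y P Q a b} → 2 * x ≡ P → 2 * y ≡ Q → P + 2 * a ≡ Q + 2 * b → x + a ≡ y + b
  halve {x} {y} {P} {Q} {a} {b} 2x≡P 2y≡Q e = *-cancelˡ-≡ (x + a) (y + b) 2 (begin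
    2 * (x + a)     ≡⟨ *-distribˡ-+ 2 x a ⟩
    2 * x + 2 * a   ≡⟨ cong (_+ 2 * a) 2x≡P ⟩
    P + 2 * a       ≡⟨ e ⟩
    Q + 2 * b       ≡⟨ cong (_+ 2 * b) 2y≡Q ⟨
    2 * y + 2 * b   ≡⟨ *-distribˡ-+ 2 y b ⟨
    2 * (y + b)     ∎)
    where open ≡-Reasoning

  arcsOf-shift : {v : SelfMap k} {w : SelfMap m} → IsPerfectMatching v → IsPerfectMatching w → ∀ κ {α β} →
    pointsOf (lookup w) κ + 2 * α ≡ pointsOf (lookup v) κ + 2 * β → arcsOf w κ + α ≡ arcsOf v κ + β
  arcsOf-shift {v = v} {w} v-pm w-pm κ {α} {β} =
    halve {x = arcsOf w κ} {arcsOf v κ} {a = α} {β} (twice-arcsOf {v = w} w-pm κ) (twice-arcsOf {v = v} v-pm κ)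

  half-suc-suc : ∀ q → (2 + q) / 2 ≡ suc (q / 2)
  half-suc-suc q = m/n≡1+[m∸n]/n {2 + q} (s≤s (s≤s z≤n))

  extendV : Fin (suc (suc m)) → SelfMap m → SelfMap (suc (suc m))
  extendV x v = tabulate (extend x (lookup v))

  module _ (v : SelfMap m) (v-pm : IsPerfectMatching v) (x : Fin (suc (suc m))) where

    private
      M : Fin m → Fin m
      M = lookup v
      M-matching : IsMatching M
      M-matching = fromPerfectMatching {v = v} v-pm
      w : SelfMap (suc (suc m))
      w = extendV x v

    extendV-pm : IsPerfectMatching w
    extendV-pm = toPerfectMatching (extend-matching x M-matching)

    pointsOf-extendV : ∀ κ → pointsOf (lookup w) κ ≡ pointsOf (extend x M) κ
    pointsOf-extendV = pointsOf-cong (lookup∘tabulate (extend x M))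

    kind-extendV : ∀ y → kind (lookup w) y ≡ kind (extend x M) y
    kind-extendV = kind-cong (lookup∘tabulate (extend x M))

  module Enclosed (v : SelfMap m) (v-pm : IsPerfectMatching v) where

    private
      M : Fin m → Fin m
      M = lookup v
      M-matching : IsMatching M
      M-matching = fromPerfectMatching {v = v} v-pm
      w : SelfMap (suc (suc m))
      w = extendV top v
      w-pm : IsPerfectMatching w
      w-pm = extendV-pm v v-pm top
      arcs : ∀ κ → arcsOf w κ + 0 ≡ arcsOf v κ + [ centered == κ ]
      arcs κ = arcsOf-shift v-pm w-pm κ (begin
        pointsOf (lookup w) κ + 0                ≡⟨ +-identityʳ _ ⟩
        pointsOf (lookup w) κ                    ≡⟨ pointsOf-extendV v v-pm top κ ⟩
        pointsOf (extend top M) κ                ≡⟨ pointsOf-cong (extend-top M) κ ⟩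
        pointsOf (enclose M) κ                   ≡⟨ pointsOf-enclose M-matching κ ⟩
        2 * [ centered == κ ] + pointsOf M κ     ≡⟨ +-comm (2 * [ centered == κ ]) (pointsOf M κ) ⟩
        pointsOf M κ + 2 * [ centered == κ ]     ∎)
        where open ≡-Reasoning

    kind-zero : kind (lookup w) zero ≡ centered
    kind-zero = trans (kind-extendV v v-pm top zero)
                      (trans (kind-cong (extend-top M) zero) (kind-enclose-zero M-matching))

    cM-eq : cM w ≡ suc (cM v)
    cM-eq = trans (sym (+-identityʳ _)) (trans (arcs centered) (+-comm _ 1))

    pM-eq : pM w ≡ pM v
    pM-eq = cong (_/ 2) (trans (sym (+-identityʳ _)) (trans (arcs coupled) (+-identityʳ _)))

    daM-eq : daM w ≡ daM v
    daM-eq = trans (sym (+-identityʳ _)) (trans (arcs asymmetric) (+-identityʳ _))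

  module Inserted (v : SelfMap m) (v-pm : IsPerfectMatching v) (a : Fin m) where

    private
      M : Fin m → Fin m
      M = lookup v
      M-matching : IsMatching M
      M-matching = fromPerfectMatching {v = v} v-pm
      module I = Insertion M-matching a
      w : SelfMap (suc (suc m))
      w = extendV (inner a) v
      w-pm : IsPerfectMatching w
      w-pm = extendV-pm v v-pm (inner a)

      arcs-insert : (h : ℕ) (α β : ArcKind → ℕ) →
        (∀ κ → pointsOf I.N κ + 2 * (h * α κ) ≡ pointsOf M κ + 2 * ((1 + h) * β κ)) →
        ∀ κ → arcsOf w κ + h * α κ ≡ arcsOf v κ + (1 + h) * β κ
      arcs-insert h α β e κ = arcsOf-shift v-pm w-pm κ
        (trans (cong (_+ 2 * (h * α κ)) (pointsOf-extendV v v-pm (inner a) κ)) (e κ))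

    kind-zero : kind (lookup w) zero ≡ kindOf false (isCentered M a)
    kind-zero = trans (kind-extendV v v-pm (inner a) zero) I.kind-N-zero

    module AtCentered (a-centered : kind M a ≡ centered) where

      private
        M-a : M a ≡ opposite a
        M-a = centered-at {f = M} {x = a} a-centered
        kind-N : kind I.N zero ≡ coupled
        kind-N = trans I.kind-N-zero (cong (kindOf false) (dec-true (M a ≟ opposite a) M-a))
        arcs : ∀ κ → arcsOf w κ + 1 * [ centered == κ ] ≡ arcsOf v κ + 2 * [ coupled == κ ]
        arcs = arcs-insert 1 (λ κ → [ centered == κ ]) (λ κ → [ coupled == κ ]) (λ κ →
          subst₂ (λ κ₁ κ₂ → pointsOf I.N κ + 2 * (1 * [ κ₁ == κ ]) ≡ pointsOf M κ + 2 * (2 * [ κ₂ == κ ]))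
                 a-centered kind-N (I.pointsOf-insert-centered M-a κ))

      kind-zero-centered : kind (lookup w) zero ≡ coupled
      kind-zero-centered = trans (kind-extendV v v-pm (inner a) zero) kind-N

      cM-eq : cM v ≡ suc (cM w)
      cM-eq = trans (sym (+-identityʳ _)) (trans (sym (arcs centered)) (+-comm _ 1))

      pM-eq : pM w ≡ suc (pM v)
      pM-eq = trans (cong (_/ 2) (trans (sym (+-identityʳ _)) (trans (arcs coupled) (+-comm _ 2))))
                    (half-suc-suc (arcsOf v coupled))

      daM-eq : daM w ≡ daM v
      daM-eq = trans (sym (+-identityʳ _)) (trans (arcs asymmetric) (+-identityʳ _))

    private
      module NotCentered (opposite-fixpoint-free : ∀ (i : Fin m) → opposite i ≢ i)
                         {κₐ : ArcKind} (a-kind : kind M a ≡ κₐ) (κₐ≢centered : κₐ ≢ centered) where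

        private
          M-a : M a ≢ opposite a
          M-a = not-centered-at {f = M} {x = a} (λ e → κₐ≢centered (trans (sym a-kind) e))
          kind-N : kind I.N zero ≡ asymmetric
          kind-N = trans I.kind-N-zero (cong (kindOf false) (dec-false (M a ≟ opposite a) M-a))

        kind-zero-not-centered : kind (lookup w) zero ≡ asymmetric
        kind-zero-not-centered = trans (kind-extendV v v-pm (inner a) zero) kind-N

        arcs : ∀ κ → arcsOf w κ + 2 * [ κₐ == κ ] ≡ arcsOf v κ + 3 * [ asymmetric == κ ]
        arcs = arcs-insert 2 (λ κ → [ κₐ == κ ]) (λ κ → [ asymmetric == κ ]) (λ κ →
          subst₂ (λ κ₁ κ₂ → pointsOf I.N κ + 2 * (2 * [ κ₁ == κ ]) ≡ pointsOf M κ + 2 * (3 * [ κ₂ == κ ]))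
                 a-kind kind-N (I.pointsOf-insert-not-centered opposite-fixpoint-free M-a κ))

    module AtCoupled (opposite-fixpoint-free : ∀ (i : Fin m) → opposite i ≢ i)
                     (a-coupled : kind M a ≡ coupled) where

      open NotCentered opposite-fixpoint-free a-coupled (λ ()) public using (kind-zero-not-centered)
      private
        arcs : ∀ κ → arcsOf w κ + 2 * [ coupled == κ ] ≡ arcsOf v κ + 3 * [ asymmetric == κ ]
        arcs = NotCentered.arcs opposite-fixpoint-free a-coupled (λ ())

      cM-eq : cM w ≡ cM v
      cM-eq = trans (sym (+-identityʳ _)) (trans (arcs centered) (+-identityʳ _))

      pM-eq : pM v ≡ suc (pM w)
      pM-eq = trans (cong (_/ 2) (trans (sym (+-identityʳ _)) (trans (sym (arcs coupled)) (+-comm _ 2))))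
                    (half-suc-suc (arcsOf w coupled))

      daM-eq : daM w ≡ 3 + daM v
      daM-eq = trans (sym (+-identityʳ _)) (trans (arcs asymmetric) (+-comm _ 3))

    module AtAsymmetric (opposite-fixpoint-free : ∀ (i : Fin m) → opposite i ≢ i)
                        (a-asymmetric : kind M a ≡ asymmetric) where

      open NotCentered opposite-fixpoint-free a-asymmetric (λ ()) public using (kind-zero-not-centered)
      private
        arcs : ∀ κ → arcsOf w κ + 2 * [ asymmetric == κ ] ≡ arcsOf v κ + 3 * [ asymmetric == κ ]
        arcs = NotCentered.arcs opposite-fixpoint-free a-asymmetric (λ ())

      cM-eq : cM w ≡ cM v
      cM-eq = trans (sym (+-identityʳ _)) (trans (arcs centered) (+-identityʳ _))

      pM-eq : pM w ≡ pM v
      pM-eq = cong (_/ 2) (trans (sym (+-identityʳ _)) (trans (arcs coupled) (+-identityʳ _)))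

      daM-eq : daM w ≡ suc (daM v)
      daM-eq = +-cancelʳ-≡ 2 (daM w) (suc (daM v)) (trans (arcs asymmetric) (+-suc (daM v) 2))

module MirrorSymmetry {k : ℕ} (opposite-fixpoint-free : ∀ (i : Fin (suc k)) → opposite i ≢ i) (a : Fin (suc k)) where

  open OuterPoints
  open Matchings
  open ArcKinds
  open ArcCounts
  open import Data.Bool using (if_then_else_)
  open import Data.Nat using (ℕ; suc; _*_)
  open import Data.Fin using (Fin; zero; opposite)
  open import Data.Fin.Properties using (_≟_; opposite-involutive)
  open import Data.Vec using (lookup; tabulate)
  open import Data.Vec.Properties using (lookup∘tabulate; tabulate-cong; tabulate∘lookup)
  open import Algebra.Definitions using (Involutive)
  open import Relation.Nullary using (yes; no; does)
  open import Relation.Nullary.Decidable using (dec-true; dec-false)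
  open import Relation.Binary.PropositionalEquality using (_≡_; _≢_; refl; sym; trans; cong; module ≡-Reasoning)
  open import Data.Nat.Properties using (*-cancelˡ-≡)

  private
    last : Fin (suc k)
    last = opposite (zero {k})
    a′ : Fin (suc k)
    a′ = opposite a

  σ : Fin (suc k) → Fin (suc k)
  σ x = if does (x ≟ zero) then a else
        if does (x ≟ a)    then zero else
        if does (x ≟ last) then a′ else
        if does (x ≟ a′)   then last else x

  σ-zero : σ zero ≡ a
  σ-zero rewrite dec-true (zero {k} ≟ zero) refl = refl

  σ-a : σ a ≡ zero
  σ-a with a ≟ zero
  ... | yes a≡0 = a≡0
  ... | no _ rewrite dec-true (a ≟ a) refl = refl

  σ-last : σ last ≡ a′
  σ-last rewrite dec-false (last ≟ zero) (opposite-fixpoint-free zero) with last ≟ a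
  ... | yes last≡a = opposite-swap last≡a
  ... | no _ rewrite dec-true (last ≟ last) refl = refl

  σ-a′ : σ a′ ≡ last
  σ-a′ with a′ ≟ zero
  ... | yes a′≡0 = opposite-swap a′≡0
  ... | no _ rewrite dec-false (a′ ≟ a) (opposite-fixpoint-free a) with a′ ≟ last
  ...   | yes a′≡last = a′≡last
  ...   | no _ rewrite dec-true (a′ ≟ a′) refl = refl

  σ-other : ∀ {x} → x ≢ zero → x ≢ a → x ≢ last → x ≢ a′ → σ x ≡ x
  σ-other {x} x≢0 x≢a x≢last x≢a′
    rewrite dec-false (x ≟ zero) x≢0 | dec-false (x ≟ a) x≢a
          | dec-false (x ≟ last) x≢last | dec-false (x ≟ a′) x≢a′ = refl

  data Orbit (x : Fin (suc k)) : Set where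
    at-zero  : x ≡ zero → Orbit x
    at-a     : x ≡ a → Orbit x
    at-last  : x ≡ last → Orbit x
    at-a′    : x ≡ a′ → Orbit x
    off      : x ≢ zero → x ≢ a → x ≢ last → x ≢ a′ → Orbit x

  orbit : ∀ x → Orbit x
  orbit x with x ≟ zero | x ≟ a | x ≟ last | x ≟ a′
  ... | yes e | _     | _     | _     = at-zero e
  ... | no _  | yes e | _     | _     = at-a e
  ... | no _  | no _  | yes e | _     = at-last e
  ... | no _  | no _  | no _  | yes e = at-a′ e
  ... | no n₁ | no n₂ | no n₃ | no n₄ = off n₁ n₂ n₃ n₄

  σ-involutive : Involutive _≡_ σ
  σ-involutive x with orbit x
  ... | at-zero refl = trans (cong σ σ-zero) σ-a
  ... | at-a refl    = trans (cong σ σ-a) σ-zero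
  ... | at-last refl = trans (cong σ σ-last) σ-a′
  ... | at-a′ refl   = trans (cong σ σ-a′) σ-last
  ... | off n₁ n₂ n₃ n₄ = trans (cong σ (σ-other n₁ n₂ n₃ n₄)) (σ-other n₁ n₂ n₃ n₄)

  σ-opposite : ∀ x → σ (opposite x) ≡ opposite (σ x)
  σ-opposite x with orbit x
  ... | at-zero refl = trans σ-last (cong opposite (sym σ-zero))
  ... | at-a refl    = trans σ-a′ (cong opposite (sym σ-a))
  ... | at-last refl = trans (cong σ (opposite-involutive zero))
                         (trans σ-zero (sym (trans (cong opposite σ-last) (opposite-involutive a))))
  ... | at-a′ refl   = trans (cong σ (opposite-involutive a))
                         (trans σ-a (sym (trans (cong opposite σ-a′) (opposite-involutive zero))))
  ... | off n₁ n₂ n₃ n₄ = trans (σ-other (λ e → n₃ (opposite-swap e)) (λ e → n₄ (opposite-swap e))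
                                          (λ e → n₁ (opposite-injective e)) (λ e → n₂ (opposite-injective e)))
                                (cong opposite (sym (σ-other n₁ n₂ n₃ n₄)))

  conjV : SelfMap (suc k) → SelfMap (suc k)
  conjV v = tabulate (conj σ (lookup v))

  conjV-pm : ∀ {v} → IsPerfectMatching v → IsPerfectMatching (conjV v)
  conjV-pm {v} v-pm = toPerfectMatching {f = conj σ (lookup v)}
    (conj-matching σ σ-involutive (fromPerfectMatching {v = v} v-pm))

  conjV-involutive : ∀ v → conjV (conjV v) ≡ v
  conjV-involutive v = begin
    tabulate (conj σ (lookup (conjV v))) ≡⟨ tabulate-cong (λ x → cong σ (lookup∘tabulate (conj σ (lookup v)) (σ x))) ⟩
    tabulate (conj σ (conj σ (lookup v))) ≡⟨ tabulate-cong (conj-conj σ σ-involutive (lookup v)) ⟩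
    tabulate (lookup v)                    ≡⟨ tabulate∘lookup v ⟩
    v                                      ∎
    where open ≡-Reasoning

  module _ {v : SelfMap (suc k)} (v-pm : IsPerfectMatching v) where

    conjV-arcsOf : ∀ κ → arcsOf (conjV v) κ ≡ arcsOf v κ
    conjV-arcsOf κ = *-cancelˡ-≡ _ _ 2 (begin
      2 * arcsOf (conjV v) κ               ≡⟨ twice-arcsOf {v = conjV v} (conjV-pm {v} v-pm) κ ⟩
      pointsOf (lookup (conjV v)) κ        ≡⟨ pointsOf-cong (lookup∘tabulate (conj σ (lookup v))) κ ⟩
      pointsOf (conj σ (lookup v)) κ       ≡⟨ pointsOf-conj σ σ-involutive σ-opposite (lookup v) κ ⟩
      pointsOf (lookup v) κ                ≡⟨ twice-arcsOf {v = v} v-pm κ ⟨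
      2 * arcsOf v κ                       ∎)
      where open ≡-Reasoning

    conjV-kind : kind (lookup (conjV v)) zero ≡ kind (lookup v) a
    conjV-kind = trans (kind-cong (lookup∘tabulate (conj σ (lookup v))) zero)
                       (trans (kind-conj σ σ-involutive σ-opposite (lookup v) zero) (cong (kind (lookup v)) σ-zero))

module ListSum {c ℓ} (R : Semiring c ℓ) where

  open import Data.List using (List; []; _∷_; map; foldr; _++_; cartesianProduct; length)
  open import Data.List.Properties using (map-∘)
  open import Data.List.Membership.Propositional using (_∈_)
  open import Data.List.Membership.Propositional.Properties using (∈-map⁺; ∈-map⁻)
  open import Data.List.Membership.Propositional.Properties.WithK using (unique∧set⇒bag)
  open import Data.List.Relation.Unary.Any using (here; there)
  open import Data.List.Relation.Unary.All as All using ()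
  open import Data.List.Relation.Unary.All.Properties as All using ()
  open import Data.List.Relation.Unary.AllPairs using ([]; _∷_)
  open import Data.List.Relation.Unary.Unique.Propositional using (Unique)
  open import Data.List.Relation.Binary.Permutation.Propositional using (_↭_; ↭⇒↭ₛ′)
  open import Data.List.Relation.Binary.Permutation.Propositional.Properties using (map⁺)
  open import Data.List.Relation.Binary.BagAndSetEquality using (∼bag⇒↭)
  import Data.List.Relation.Binary.Permutation.Setoid.Properties as SetoidPermutation
  open import Data.Product using (_×_; _,_)
  open import Function using (_∘_)
  open import Function.Bundles using (mk⇔)
  open import Relation.Binary.PropositionalEquality as ≡ using (_≡_)

  open Semiring R
  open import Algebra.Definitions.RawSemiring rawSemiring using () renaming (_×_ to _·_)
  open import Algebra.Properties.CommutativeSemigroup +-commutativeSemigroup using (interchange)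
  open import Relation.Binary.Reasoning.Setoid setoid

  ∑ : ∀ {a} {A : Set a} → List A → (A → Carrier) → Carrier
  ∑ xs f = foldr _+_ 0# (map f xs)

  syntax ∑ xs (λ x → e) = ∑[ x ∈ xs ] e

  module _ {a} {A : Set a} where

    ∑-cong : (xs : List A) {f g : A → Carrier} → (∀ {x} → x ∈ xs → f x ≈ g x) → ∑ xs f ≈ ∑ xs g
    ∑-cong []       f≈g = refl
    ∑-cong (x ∷ xs) f≈g = +-cong (f≈g (here ≡.refl)) (∑-cong xs (f≈g ∘ there))

    ∑-zero : (xs : List A) → ∑[ _ ∈ xs ] 0# ≈ 0#
    ∑-zero []       = refl
    ∑-zero (x ∷ xs) = trans (+-identityˡ _) (∑-zero xs)

    ∑-const : (xs : List A) (y : Carrier) → ∑[ _ ∈ xs ] y ≈ length xs · y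
    ∑-const []       y = refl
    ∑-const (x ∷ xs) y = +-congˡ (∑-const xs y)

    ∑-++ : (xs ys : List A) (f : A → Carrier) → ∑ (xs ++ ys) f ≈ ∑ xs f + ∑ ys f
    ∑-++ []       ys f = sym (+-identityˡ _)
    ∑-++ (x ∷ xs) ys f = trans (+-congˡ (∑-++ xs ys f)) (sym (+-assoc _ _ _))

    ∑-distrib-+ : (xs : List A) (f g : A → Carrier) → ∑[ x ∈ xs ] (f x + g x) ≈ ∑ xs f + ∑ xs g
    ∑-distrib-+ []       f g = sym (+-identityˡ _)
    ∑-distrib-+ (x ∷ xs) f g = trans (+-congˡ (∑-distrib-+ xs f g)) (interchange (f x) (g x) (∑ xs f) (∑ xs g))

    ∑-*ˡ : (xs : List A) (y : Carrier) (f : A → Carrier) → ∑[ x ∈ xs ] (y * f x) ≈ y * ∑ xs f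
    ∑-*ˡ []       y f = sym (zeroʳ y)
    ∑-*ˡ (x ∷ xs) y f = trans (+-congˡ (∑-*ˡ xs y f)) (sym (distribˡ y _ _))

    ∑-↭ : {xs ys : List A} (f : A → Carrier) → xs ↭ ys → ∑ xs f ≈ ∑ ys f
    ∑-↭ f xs↭ys =
      SetoidPermutation.foldr-commMonoid setoid +-isCommutativeMonoid (↭⇒↭ₛ′ isEquivalence (map⁺ f xs↭ys))

  ∑-map : ∀ {a b} {A : Set a} {B : Set b} (xs : List A) (g : A → B) (f : B → Carrier) → ∑ (map g xs) f ≈ ∑ xs (f ∘ g)
  ∑-map xs g f = reflexive (≡.cong (foldr _+_ 0#) (≡.sym (map-∘ xs)))

  ∑-cartesianProduct : ∀ {a b} {A : Set a} {B : Set b} (xs : List A) (ys : List B) (f : A × B → Carrier) →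
    ∑ (cartesianProduct xs ys) f ≈ ∑[ x ∈ xs ] ∑[ y ∈ ys ] f (x , y)
  ∑-cartesianProduct []       ys f = refl
  ∑-cartesianProduct (x ∷ xs) ys f = trans (∑-++ (map (x ,_) ys) (cartesianProduct xs ys) f)
    (+-cong (∑-map ys (x ,_) f) (∑-cartesianProduct xs ys f))

  private
    unique-map⁺ : ∀ {a b} {A : Set a} {B : Set b} (g : A → B) {xs : List A} →
      (∀ {x y} → x ∈ xs → y ∈ xs → g x ≡ g y → x ≡ y) → Unique xs → Unique (map g xs)
    unique-map⁺ g {[]}     g-injective []                    = []
    unique-map⁺ g {x ∷ xs} g-injective (x∉xs ∷ xs-unique) =
      All.map⁺ (All.tabulate (λ y∈xs gx≡gy → All.lookup x∉xs y∈xs (g-injective (here ≡.refl) (there y∈xs) gx≡gy))) ∷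
      unique-map⁺ g (λ x∈ y∈ → g-injective (there x∈) (there y∈)) xs-unique

  ∑-bijection : ∀ {a b} {A : Set a} {B : Set b} {xs : List A} {ys : List B} (g : A → B) (h : B → A) →
    Unique xs → Unique ys → (∀ {x} → x ∈ xs → g x ∈ ys) → (∀ {y} → y ∈ ys → h y ∈ xs) →
    (∀ {x} → x ∈ xs → h (g x) ≡ x) → (∀ {y} → y ∈ ys → g (h y) ≡ y) →
    (f : B → Carrier) → ∑ ys f ≈ ∑ xs (f ∘ g)
  ∑-bijection {xs = xs} {ys} g h xs-unique ys-unique g∈ h∈ hg gh f = begin
    ∑ ys f         ≈⟨ ∑-↭ f (∼bag⇒↭ (unique∧set⇒bag ys-unique gxs-unique (mk⇔ to from))) ⟩
    ∑ (map g xs) f ≈⟨ ∑-map xs g f ⟩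
    ∑ xs (f ∘ g)   ∎
    where
    gxs-unique : Unique (map g xs)
    gxs-unique = unique-map⁺ g (λ x∈ y∈ gx≡gy → ≡.trans (≡.sym (hg x∈)) (≡.trans (≡.cong h gx≡gy) (hg y∈))) xs-unique
    to : ∀ {y} → y ∈ ys → y ∈ map g xs
    to y∈ = ≡.subst (_∈ map g xs) (gh y∈) (∈-map⁺ g (h∈ y∈))
    from : ∀ {y} → y ∈ map g xs → y ∈ ys
    from y∈ with ∈-map⁻ g y∈
    ... | x , x∈ , ≡.refl = g∈ x∈

module MatchingLists where

  open OuterPoints
  open Matchings
  open ArcKinds
  open ArcCounts
  open import Data.Nat using (ℕ; zero; suc)
  open import Data.Fin using (Fin; zero; suc)
  open import Data.Vec using (Vec; []; _∷_; lookup; tabulate)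
  open import Data.Vec.Properties using (∷-injective; lookup∘tabulate; tabulate-cong; tabulate∘lookup)
  open import Data.List using (List; []; _∷_; map; filter; allFin; concatMap; cartesianProduct; cartesianProductWith; _++_)
  open import Data.List.Membership.Propositional using (_∈_)
  open import Data.List.Membership.Propositional.Properties
    using (∈-filter⁺; ∈-filter⁻; ∈-allFin; ∈-cartesianProductWith⁺; ∈-cartesianProduct⁺; ∈-cartesianProduct⁻; ∈-map⁺; ∈-map⁻)
  open import Data.List.Relation.Unary.Any using (here; there)
  open import Data.List.Relation.Unary.All as All using ()
  open import Data.List.Relation.Unary.All.Properties as All using ()
  open import Data.List.Relation.Unary.AllPairs using ([]; _∷_)
  open import Data.List.Relation.Unary.Unique.Propositional using (Unique)
  open import Data.List.Relation.Unary.Unique.Propositional.Properties as Unique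
    using (allFin⁺; filter⁺; cartesianProductWith⁺; cartesianProduct⁺)
  open import Data.Product using (_×_; _,_; proj₁; proj₂)
  open import Data.Empty using (⊥-elim)
  open import Relation.Binary.PropositionalEquality using (_≡_; _≢_; _≗_; refl; sym; trans; cong; cong₂; subst)

  private
    variable
      k m : ℕ

  allVecs-suc : ∀ {a} {A : Set a} (xs : List A) k → allVecs xs (suc k) ≡ cartesianProductWith _∷_ xs (allVecs xs k)
  allVecs-suc xs k = go xs
    where
    go : ∀ ys → concatMap (λ y → map (y ∷_) (allVecs xs k)) ys ≡ cartesianProductWith _∷_ ys (allVecs xs k)
    go []       = refl
    go (y ∷ ys) = cong (map (y ∷_) (allVecs xs k) ++_) (go ys)

  ∈-allVecs : ∀ {a} {A : Set a} {xs : List A} → (∀ x → x ∈ xs) → (v : Vec A k) → v ∈ allVecs xs k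
  ∈-allVecs ∈xs []                = here refl
  ∈-allVecs {xs = xs} ∈xs (x ∷ v) = subst (x ∷ v ∈_) (sym (allVecs-suc xs _))
    (∈-cartesianProductWith⁺ _∷_ (∈xs x) (∈-allVecs ∈xs v))

  allVecs-unique : ∀ {a} {A : Set a} {xs : List A} → Unique xs → ∀ k → Unique (allVecs xs k)
  allVecs-unique xs-unique zero        = All.[] ∷ []
  allVecs-unique {xs = xs} xs-unique (suc k) = subst Unique (sym (allVecs-suc xs k))
    (cartesianProductWith⁺ _∷_ ∷-injective xs-unique (allVecs-unique xs-unique k))

  perfectMatchings : (k : ℕ) → List (SelfMap k)
  perfectMatchings k = filter isPerfectMatching? (allVecs (allFin k) k)

  ∈-perfectMatchings⁺ : {v : SelfMap k} → IsPerfectMatching v → v ∈ perfectMatchings k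
  ∈-perfectMatchings⁺ v-pm = ∈-filter⁺ isPerfectMatching? (∈-allVecs ∈-allFin _) v-pm

  ∈-perfectMatchings⁻ : {v : SelfMap k} → v ∈ perfectMatchings k → IsPerfectMatching v
  ∈-perfectMatchings⁻ {k} v∈ = proj₂ (∈-filter⁻ isPerfectMatching? {xs = allVecs (allFin k) k} v∈)

  perfectMatchings-unique : ∀ k → Unique (perfectMatchings k)
  perfectMatchings-unique k = filter⁺ isPerfectMatching? (allVecs-unique (allFin⁺ k) k)

  partners : (m : ℕ) → List (Fin (suc (suc m)))
  partners m = top ∷ map inner (allFin m)

  partners-unique : Unique (partners m)
  partners-unique {m} =
    All.map⁺ (All.tabulate (λ _ top≡inner → inner≢top (sym top≡inner))) ∷ Unique.map⁺ inner-injective (allFin⁺ m)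

  ∈-partners : {x : Fin (suc (suc m))} → x ≢ zero → x ∈ partners m
  ∈-partners {m} {x} = point-elim {P = λ x → x ≢ zero → x ∈ partners m}
    (λ 0≢0 → ⊥-elim (0≢0 refl))
    (λ _ → here refl)
    (λ j _ → there (∈-map⁺ inner (∈-allFin j)))
    x

  partners-nonzero : {x : Fin (suc (suc m))} → x ∈ partners m → x ≢ zero
  partners-nonzero (here refl) ()
  partners-nonzero (there x∈)  x≡0 with ∈-map⁻ inner x∈
  ... | j , _ , refl = inner≢zero x≡0

  decompositions : (m : ℕ) → List (Fin (suc (suc m)) × SelfMap m)
  decompositions m = cartesianProduct (partners m) (perfectMatchings m)

  decompositions-unique : Unique (decompositions m)
  decompositions-unique {m} = cartesianProduct⁺ partners-unique (perfectMatchings-unique m)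

  compose : Fin (suc (suc m)) × SelfMap m → SelfMap (suc (suc m))
  compose (x , v) = extendV x v

  decompose : SelfMap (suc (suc m)) → Fin (suc (suc m)) × SelfMap m
  decompose w = lookup w zero , tabulate (retract (lookup w))

  compose-∈ : {p : Fin (suc (suc m)) × SelfMap m} → p ∈ decompositions m → compose p ∈ perfectMatchings (suc (suc m))
  compose-∈ {m} {x , v} p∈ = ∈-perfectMatchings⁺ (extendV-pm v v-pm x)
    where
    v-pm : IsPerfectMatching v
    v-pm = ∈-perfectMatchings⁻ (proj₂ (∈-cartesianProduct⁻ (partners m) (perfectMatchings m) p∈))

  module _ {p : Fin (suc (suc m)) × SelfMap m} (p∈ : p ∈ decompositions m) where

    private
      x : Fin (suc (suc m))
      x = proj₁ p
      v : SelfMap m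
      v = proj₂ p
      M : Fin m → Fin m
      M = lookup v
      x∈ : x ∈ partners m
      x∈ = proj₁ (∈-cartesianProduct⁻ (partners m) (perfectMatchings m) p∈)
      x≢0 : x ≢ zero
      x≢0 = partners-nonzero x∈
      N≗ : lookup (tabulate (extend x M)) ≗ extend x M
      N≗ = lookup∘tabulate (extend x M)

    decompose-compose : decompose (compose p) ≡ p
    decompose-compose = cong₂ _,_
      (trans (N≗ zero) (extend-zero x M x≢0))
      (trans (tabulate-cong (λ j → trans (retract-cong N≗ j) (retract-extend x x≢0 j))) (tabulate∘lookup v))

  module _ {w : SelfMap (suc (suc m))} (w∈ : w ∈ perfectMatchings (suc (suc m))) where

    private
      N = lookup w
      N-matching = fromPerfectMatching {v = w} (∈-perfectMatchings⁻ w∈)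

    decompose-∈ : decompose w ∈ decompositions m
    decompose-∈ = ∈-cartesianProduct⁺ (∈-partners (fixpoint-free N-matching zero))
      (∈-perfectMatchings⁺ (toPerfectMatching (retract-matching N-matching)))

    compose-decompose : compose (decompose w) ≡ w
    compose-decompose = trans
      (tabulate-cong (λ y → trans (extend-cong (N zero) (lookup∘tabulate (retract N)) y) (extend-retract N-matching y)))
      (tabulate∘lookup w)

module Weights {c ℓ} (R : CommutativeRing c ℓ) (r s t : CommutativeRing.Carrier R) where

  open OuterPoints
  open ArcKinds
  open ArcCounts
  open import Data.Bool using (true; false)
  open import Data.Nat as ℕ using (ℕ; zero; suc)
  open import Data.Fin using (Fin; zero; opposite)
  open import Data.Vec using (lookup)
  open import Data.Nat.DivMod using (_/_)
  open import Relation.Binary.PropositionalEquality as ≡ using (_≡_; _≢_)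

  open CommutativeRing R hiding (zero)
  open import Algebra.Definitions.RawSemiring (Semiring.rawSemiring semiring) using (_^_)
  open import Algebra.Properties.CommutativeSemigroup *-commutativeSemigroup using (x∙yz≈y∙xz)
  open import Relation.Binary.Reasoning.Setoid setoid

  private
    variable
      k m : ℕ

  monomial : ℕ → ℕ → ℕ → Carrier
  monomial c p d = r ^ c * (s ^ p * t ^ d)

  monomial-sucˡ : ∀ c p d → monomial (suc c) p d ≈ r * monomial c p d
  monomial-sucˡ c p d = *-assoc r _ _

  monomial-sucᵐ : ∀ c p d → monomial c (suc p) d ≈ s * monomial c p d
  monomial-sucᵐ c p d = trans (*-congˡ (*-assoc s (s ^ p) (t ^ d))) (x∙yz≈y∙xz (r ^ c) s _)

  monomial-sucʳ : ∀ c p d → monomial c p (suc d) ≈ t * monomial c p d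
  monomial-sucʳ c p d = trans (*-congˡ (x∙yz≈y∙xz (s ^ p) t (t ^ d))) (x∙yz≈y∙xz (r ^ c) t _)

  monomial-2+ʳ : ∀ c p d → monomial c p (2 ℕ.+ d) ≈ (t * t) * monomial c p d
  monomial-2+ʳ c p d = begin
    monomial c p (2 ℕ.+ d)      ≈⟨ monomial-sucʳ c p (suc d) ⟩
    t * monomial c p (suc d)    ≈⟨ *-congˡ (monomial-sucʳ c p d) ⟩
    t * (t * monomial c p d)    ≈⟨ *-assoc t t _ ⟨
    (t * t) * monomial c p d    ∎

  weight : SelfMap k → Carrier
  weight v = monomial (cM v) (pM v) (daM v)

  -- the weight with the centered arc at the point deleted (0 if that arc is not centered)
  centeredPart′ : ArcKind → ℕ → ℕ → ℕ → Carrier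
  centeredPart′ centered (suc c) p d = monomial c p d
  centeredPart′ _        _       _ _ = 0#

  -- the weight with the arcs at the point and at its mirror counted as asymmetric (0 if centered)
  asymmetricPart′ : ArcKind → ℕ → ℕ → ℕ → Carrier
  asymmetricPart′ coupled    c (suc p) d = monomial c p (2 ℕ.+ d)
  asymmetricPart′ asymmetric c p       d = monomial c p d
  asymmetricPart′ _          _ _       _ = 0#

  atPoint : (ArcKind → ℕ → ℕ → ℕ → Carrier) → SelfMap k → Fin k → Carrier
  atPoint F v x = F (kind (lookup v) x) (cM v) (pM v) (daM v)

  centeredPart asymmetricPart : SelfMap k → Fin k → Carrier
  centeredPart   = atPoint centeredPart′
  asymmetricPart = atPoint asymmetricPart′

  atPoint-≡ : ∀ F (v : SelfMap k) (x : Fin k) {κ c p d} →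
    kind (lookup v) x ≡ κ → cM v ≡ c → pM v ≡ p → daM v ≡ d → atPoint F v x ≡ F κ c p d
  atPoint-≡ F v x ≡.refl ≡.refl ≡.refl ≡.refl = ≡.refl

  weight-≡ : (v : SelfMap k) {c p d : ℕ} → cM v ≡ c → pM v ≡ p → daM v ≡ d → weight v ≡ monomial c p d
  weight-≡ v ≡.refl ≡.refl ≡.refl = ≡.refl

  module _ (v : SelfMap m) (v-pm : IsPerfectMatching v) where

    private
      w : SelfMap (suc (suc m))
      w = extendV top v
      open Enclosed v v-pm

    weight-enclose : weight w ≈ r * weight v
    weight-enclose = trans (reflexive (weight-≡ w cM-eq pM-eq daM-eq)) (monomial-sucˡ (cM v) (pM v) (daM v))

    centeredPart-enclose : centeredPart w zero ≈ weight v
    centeredPart-enclose = reflexive (atPoint-≡ centeredPart′ w zero kind-zero cM-eq pM-eq daM-eq)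

    asymmetricPart-enclose : asymmetricPart w zero ≈ 0#
    asymmetricPart-enclose = reflexive (≡.cong (λ κ → asymmetricPart′ κ (cM w) (pM w) (daM w)) kind-zero)

  module _ (opposite-fixpoint-free : ∀ (i : Fin m) → opposite i ≢ i)
           (v : SelfMap m) (v-pm : IsPerfectMatching v) (a : Fin m) where

    private
      w : SelfMap (suc (suc m))
      w = extendV (inner a) v
      κₐ : ArcKind
      κₐ = kind (lookup v) a
      open Inserted v v-pm a
      +-zeroʳ : ∀ x y → x ≈ x + y * 0#
      +-zeroʳ x y = sym (trans (+-congˡ (zeroʳ y)) (+-identityʳ x))
      zero-+ : ∀ x y → y ≈ x * 0# + y
      zero-+ x y = sym (trans (+-congʳ (zeroʳ x)) (+-identityˡ y))

    weight-insert : weight w ≈ s * centeredPart v a + t * asymmetricPart v a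
    weight-insert with κₐ in eq
    ... | centered = begin
      weight w                                          ≡⟨ weight-≡ w ≡.refl pM-eq daM-eq ⟩
      monomial (cM w) (suc (pM v)) (daM v)              ≈⟨ monomial-sucᵐ (cM w) (pM v) (daM v) ⟩
      s * monomial (cM w) (pM v) (daM v)                ≡⟨ ≡.cong (λ c → s * centeredPart′ centered c (pM v) (daM v)) cM-eq ⟨
      s * centeredPart′ centered (cM v) (pM v) (daM v)  ≈⟨ +-zeroʳ _ t ⟩
      s * centeredPart′ centered (cM v) (pM v) (daM v) + t * 0# ∎
      where open AtCentered eq
    ... | coupled = begin
      weight w                                            ≡⟨ weight-≡ w cM-eq ≡.refl daM-eq ⟩
      monomial (cM v) (pM w) (3 ℕ.+ daM v)                ≈⟨ monomial-sucʳ (cM v) (pM w) (2 ℕ.+ daM v) ⟩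
      t * monomial (cM v) (pM w) (2 ℕ.+ daM v)            ≡⟨ ≡.cong (λ p → t * asymmetricPart′ coupled (cM v) p (daM v)) pM-eq ⟨
      t * asymmetricPart′ coupled (cM v) (pM v) (daM v)   ≈⟨ zero-+ s _ ⟩
      s * 0# + t * asymmetricPart′ coupled (cM v) (pM v) (daM v) ∎
      where open AtCoupled opposite-fixpoint-free eq
    ... | asymmetric = begin
      weight w                                     ≡⟨ weight-≡ w cM-eq pM-eq daM-eq ⟩
      monomial (cM v) (pM v) (suc (daM v))         ≈⟨ monomial-sucʳ (cM v) (pM v) (daM v) ⟩
      t * monomial (cM v) (pM v) (daM v)           ≈⟨ zero-+ s _ ⟩
      s * 0# + t * monomial (cM v) (pM v) (daM v)  ∎
      where open AtAsymmetric opposite-fixpoint-free eq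

    centeredPart-insert : centeredPart w zero ≈ 0#
    centeredPart-insert = reflexive (≡.trans (≡.cong (λ κ → centeredPart′ κ (cM w) (pM w) (daM w)) kind-zero)
                                             (vanishes (isCentered (lookup v) a)))
      where
      vanishes : ∀ b → centeredPart′ (kindOf false b) (cM w) (pM w) (daM w) ≡ 0#
      vanishes true  = ≡.refl
      vanishes false = ≡.refl

    asymmetricPart-insert : asymmetricPart w zero ≈ (t * t) * centeredPart v a + t * asymmetricPart v a
    asymmetricPart-insert with κₐ in eq
    ... | centered = begin
      asymmetricPart w zero                                   ≡⟨ atPoint-≡ asymmetricPart′ w zero kind-zero-centered ≡.refl pM-eq daM-eq ⟩
      monomial (cM w) (pM v) (2 ℕ.+ daM v)                    ≈⟨ monomial-2+ʳ (cM w) (pM v) (daM v) ⟩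
      (t * t) * monomial (cM w) (pM v) (daM v)                ≡⟨ ≡.cong (λ c → (t * t) * centeredPart′ centered c (pM v) (daM v)) cM-eq ⟨
      (t * t) * centeredPart′ centered (cM v) (pM v) (daM v)  ≈⟨ +-zeroʳ _ t ⟩
      (t * t) * centeredPart′ centered (cM v) (pM v) (daM v) + t * 0# ∎
      where open AtCentered eq
    ... | coupled = begin
      asymmetricPart w zero                                   ≡⟨ atPoint-≡ asymmetricPart′ w zero kind-zero-not-centered cM-eq ≡.refl daM-eq ⟩
      monomial (cM v) (pM w) (3 ℕ.+ daM v)                    ≈⟨ monomial-sucʳ (cM v) (pM w) (2 ℕ.+ daM v) ⟩
      t * monomial (cM v) (pM w) (2 ℕ.+ daM v)                ≡⟨ ≡.cong (λ p → t * asymmetricPart′ coupled (cM v) p (daM v)) pM-eq ⟨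
      t * asymmetricPart′ coupled (cM v) (pM v) (daM v)       ≈⟨ zero-+ (t * t) _ ⟩
      (t * t) * 0# + t * asymmetricPart′ coupled (cM v) (pM v) (daM v) ∎
      where open AtCoupled opposite-fixpoint-free eq
    ... | asymmetric = begin
      asymmetricPart w zero                                   ≡⟨ atPoint-≡ asymmetricPart′ w zero kind-zero-not-centered cM-eq pM-eq daM-eq ⟩
      monomial (cM v) (pM v) (suc (daM v))                    ≈⟨ monomial-sucʳ (cM v) (pM v) (daM v) ⟩
      t * monomial (cM v) (pM v) (daM v)                      ≈⟨ zero-+ (t * t) _ ⟩
      (t * t) * 0# + t * monomial (cM v) (pM v) (daM v)       ∎
      where open AtAsymmetric opposite-fixpoint-free eq

  module _ {k : ℕ} (opposite-fixpoint-free : ∀ (i : Fin (suc k)) → opposite i ≢ i) (a : Fin (suc k)) where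

    open MirrorSymmetry opposite-fixpoint-free a

    atPoint-conjV : ∀ F {v} → IsPerfectMatching v → atPoint F (conjV v) zero ≡ atPoint F v a
    atPoint-conjV F {v} v-pm = atPoint-≡ F (conjV v) zero (conjV-kind {v} v-pm)
      (conjV-arcsOf {v} v-pm centered) (≡.cong (_/ 2) (conjV-arcsOf {v} v-pm coupled)) (conjV-arcsOf {v} v-pm asymmetric)

module Recurrences {c ℓ} (R : CommutativeRing c ℓ) (r s t : CommutativeRing.Carrier R) where

  open OuterPoints
  open ArcCounts
  open MatchingLists
  open import Data.Nat as ℕ using (ℕ; zero; suc)
  open import Data.Fin using (Fin; zero; opposite)
  open import Data.List using (map; allFin; length)
  open import Data.List.Properties using (length-tabulate)
  open import Data.List.Membership.Propositional using (_∈_)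
  open import Function using (_∘_)
  open import Relation.Binary.PropositionalEquality as ≡ using (_≡_; _≢_)

  open CommutativeRing R hiding (zero)
  open Weights R r s t
  open ListSum semiring
  open import Algebra.Definitions.RawSemiring (Semiring.rawSemiring semiring) using () renaming (_×_ to _·_)
  open import Relation.Binary.Reasoning.Setoid setoid

  private
    variable
      m : ℕ

  ∑-decompose : (F : SelfMap (suc (suc m)) → Carrier) →
    ∑ (perfectMatchings (suc (suc m))) F ≈
      ∑[ v ∈ perfectMatchings m ] F (extendV top v) + ∑[ a ∈ allFin m ] ∑[ v ∈ perfectMatchings m ] F (extendV (inner a) v)
  ∑-decompose {m} F = begin
    ∑ (perfectMatchings (suc (suc m))) F
      ≈⟨ ∑-bijection compose decompose decompositions-unique (perfectMatchings-unique _)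
                     compose-∈ decompose-∈ decompose-compose compose-decompose F ⟩
    ∑ (decompositions m) (F ∘ compose)
      ≈⟨ ∑-cartesianProduct (partners m) (perfectMatchings m) (F ∘ compose) ⟩
    ∑[ v ∈ perfectMatchings m ] F (extendV top v) + ∑[ x ∈ map inner (allFin m) ] ∑[ v ∈ perfectMatchings m ] F (extendV x v)
      ≈⟨ +-congˡ (∑-map (allFin m) inner (λ x → ∑[ v ∈ perfectMatchings m ] F (extendV x v))) ⟩
    ∑[ v ∈ perfectMatchings m ] F (extendV top v) + ∑[ a ∈ allFin m ] ∑[ v ∈ perfectMatchings m ] F (extendV (inner a) v) ∎

  module _ {k : ℕ} (opposite-fixpoint-free : ∀ (i : Fin (suc k)) → opposite i ≢ i) (a : Fin (suc k)) where

    open MirrorSymmetry opposite-fixpoint-free a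

    ∑-conjV : (F : SelfMap (suc k) → Carrier) → ∑ (perfectMatchings (suc k)) F ≈ ∑ (perfectMatchings (suc k)) (F ∘ conjV)
    ∑-conjV = ∑-bijection conjV conjV (perfectMatchings-unique _) (perfectMatchings-unique _)
      conjV-∈ conjV-∈
      (λ {v} _ → conjV-involutive v) (λ {v} _ → conjV-involutive v)
      where
      conjV-∈ : ∀ {v} → v ∈ perfectMatchings (suc k) → conjV v ∈ perfectMatchings (suc k)
      conjV-∈ {v} v∈ = ∈-perfectMatchings⁺ (conjV-pm {v} (∈-perfectMatchings⁻ v∈))

  total : ℕ → Carrier
  total k = ∑ (perfectMatchings k) weight

  centeredSum asymmetricSum : ℕ → Carrier
  centeredSum   k = ∑[ v ∈ perfectMatchings (suc k) ] centeredPart v zero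
  asymmetricSum k = ∑[ v ∈ perfectMatchings (suc k) ] asymmetricPart v zero

  module _ (opposite-fixpoint-free : ∀ (i : Fin m) → opposite i ≢ i) where

    private
      pm : ∀ {n} {v : SelfMap n} → v ∈ perfectMatchings n → IsPerfectMatching v
      pm = ∈-perfectMatchings⁻

    total-suc-suc : total (suc (suc m)) ≈
      r * total m + ∑[ a ∈ allFin m ] ∑[ v ∈ perfectMatchings m ] (s * centeredPart v a + t * asymmetricPart v a)
    total-suc-suc = trans (∑-decompose {m} weight) (+-cong
      (trans (∑-cong (perfectMatchings m) (λ {v} v∈ → weight-enclose v (pm v∈))) (∑-*ˡ (perfectMatchings m) r weight))
      (∑-cong (allFin m) (λ {a} _ → ∑-cong (perfectMatchings m) (λ {v} v∈ → weight-insert opposite-fixpoint-free v (pm v∈) a))))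

    centeredSum-suc : centeredSum (suc m) ≈ total m
    centeredSum-suc = trans (∑-decompose {m} (λ w → centeredPart w zero)) (trans (+-cong
      (∑-cong (perfectMatchings m) (λ {v} v∈ → centeredPart-enclose v (pm v∈)))
      (trans (∑-cong (allFin m) (λ {a} _ →
                trans (∑-cong (perfectMatchings m) (λ {v} v∈ → centeredPart-insert opposite-fixpoint-free v (pm v∈) a))
                                                 (∑-zero (perfectMatchings m))))
             (∑-zero (allFin m))))
      (+-identityʳ _))

    asymmetricSum-suc : asymmetricSum (suc m) ≈
      ∑[ a ∈ allFin m ] ∑[ v ∈ perfectMatchings m ] ((t * t) * centeredPart v a + t * asymmetricPart v a)
    asymmetricSum-suc = trans (∑-decompose {m} (λ w → asymmetricPart w zero)) (trans (+-cong
      (trans (∑-cong (perfectMatchings m) (λ {v} v∈ → asymmetricPart-enclose v (pm v∈))) (∑-zero (perfectMatchings m)))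
      (∑-cong (allFin m) (λ {a} _ → ∑-cong (perfectMatchings m) (λ {v} v∈ → asymmetricPart-insert opposite-fixpoint-free v (pm v∈) a))))
      (+-identityˡ _))

  module _ {k : ℕ} (opposite-fixpoint-free : ∀ (i : Fin (suc k)) → opposite i ≢ i) (x y : Carrier) where

    private
      pm : ∀ {n} {v : SelfMap n} → v ∈ perfectMatchings n → IsPerfectMatching v
      pm = ∈-perfectMatchings⁻

    ∑-at-point : ∀ a → ∑[ v ∈ perfectMatchings (suc k) ] (x * centeredPart v a + y * asymmetricPart v a) ≈
                       x * centeredSum k + y * asymmetricSum k
    ∑-at-point a = begin
      ∑[ v ∈ perfectMatchings (suc k) ] (x * centeredPart v a + y * asymmetricPart v a)
        ≈⟨ ∑-cong (perfectMatchings (suc k)) (λ {v} v∈ → sym (+-cong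
             (*-congˡ (reflexive (atPoint-conjV opposite-fixpoint-free a centeredPart′ {v} (pm v∈))))
             (*-congˡ (reflexive (atPoint-conjV opposite-fixpoint-free a asymmetricPart′ {v} (pm v∈)))))) ⟩
      ∑[ v ∈ perfectMatchings (suc k) ] (x * centeredPart (conjV v) zero + y * asymmetricPart (conjV v) zero)
        ≈⟨ ∑-conjV opposite-fixpoint-free a (λ v → x * centeredPart v zero + y * asymmetricPart v zero) ⟨
      ∑[ v ∈ perfectMatchings (suc k) ] (x * centeredPart v zero + y * asymmetricPart v zero)
        ≈⟨ ∑-distrib-+ (perfectMatchings (suc k)) (λ v → x * centeredPart v zero) (λ v → y * asymmetricPart v zero) ⟩
      ∑[ v ∈ perfectMatchings (suc k) ] (x * centeredPart v zero) +
        ∑[ v ∈ perfectMatchings (suc k) ] (y * asymmetricPart v zero)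
        ≈⟨ +-cong (∑-*ˡ (perfectMatchings (suc k)) x (λ v → centeredPart v zero))
                  (∑-*ˡ (perfectMatchings (suc k)) y (λ v → asymmetricPart v zero)) ⟩
      x * centeredSum k + y * asymmetricSum k ∎
      where open MirrorSymmetry opposite-fixpoint-free a using (conjV)

    ∑-all-points : ∑[ a ∈ allFin (suc k) ] ∑[ v ∈ perfectMatchings (suc k) ] (x * centeredPart v a + y * asymmetricPart v a) ≈
                   suc k · (x * centeredSum k + y * asymmetricSum k)
    ∑-all-points = begin
      _ ≈⟨ ∑-cong (allFin (suc k)) (λ {a} _ → ∑-at-point a) ⟩
      _ ≈⟨ ∑-const (allFin (suc k)) _ ⟩
      length (allFin (suc k)) · (x * centeredSum k + y * asymmetricSum k)
        ≡⟨ ≡.cong (_· (x * centeredSum k + y * asymmetricSum k)) (length-tabulate {n = suc k} (λ i → i)) ⟩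
      suc k · (x * centeredSum k + y * asymmetricSum k) ∎

module EvenRecurrences {c ℓ} (R : CommutativeRing c ℓ) (r s t : CommutativeRing.Carrier R) where

  open OuterPoints
  open MatchingLists
  open import Data.Nat as ℕ using (ℕ; zero; suc)
  open import Data.List using (allFin)
  open import Data.Fin using (Fin; opposite)
  open import Function using (_∘_)
  open import Relation.Binary.PropositionalEquality as ≡ using (_≡_; _≢_)

  open CommutativeRing R hiding (zero)
  open Weights R r s t
  open Recurrences R r s t
  open ListSum semiring
  open import Algebra.Definitions.RawSemiring (Semiring.rawSemiring semiring) using () renaming (_×_ to _·_)
  open import Algebra.Properties.Semiring.Mult semiring using (×-congʳ)
  open import Relation.Binary.Reasoning.Setoid setoid

  A H : ℕ → Carrier
  A n = total (2 ℕ.* n)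
  H n = asymmetricSum (suc (2 ℕ.* n))

  private
    opp-fixpoint-free : ∀ n (i : Fin (2 ℕ.* n)) → opposite i ≢ i
    opp-fixpoint-free = opposite-fixpoint-free-even

    centeredSum-even : ∀ n → centeredSum (ℕ.pred (2 ℕ.* suc n)) ≈ A n
    centeredSum-even n =
      trans (reflexive (≡.cong (centeredSum ∘ ℕ.pred) (twice-suc n))) (centeredSum-suc (opp-fixpoint-free n))

    asymmetricSum-even : ∀ n → asymmetricSum (ℕ.pred (2 ℕ.* suc n)) ≈ H n
    asymmetricSum-even n = reflexive (≡.cong (asymmetricSum ∘ ℕ.pred) (twice-suc n))

    ∑-all-points-even : ∀ n x y →
      ∑[ i ∈ allFin (2 ℕ.* suc n) ] ∑[ v ∈ perfectMatchings (2 ℕ.* suc n) ] (x * centeredPart v i + y * asymmetricPart v i)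
        ≈ (2 ℕ.* suc n) · (x * A n + y * H n)
    ∑-all-points-even n x y = trans (∑-all-points (opp-fixpoint-free (suc n)) x y)
      (×-congʳ (2 ℕ.* suc n) (+-cong (*-congˡ (centeredSum-even n)) (*-congˡ (asymmetricSum-even n))))

  A-zero : A 0 ≈ 1#
  A-zero = trans (+-identityʳ _) (trans (*-identityˡ _) (*-identityˡ _))

  A-one : A 1 ≈ r * A 0
  A-one = trans (total-suc-suc (opp-fixpoint-free 0)) (+-identityʳ _)

  A-suc-suc : ∀ n → A (suc (suc n)) ≈ r * A (suc n) + (2 ℕ.* suc n) · (s * A n + t * H n)
  A-suc-suc n = begin
    total (2 ℕ.* suc (suc n))                   ≡⟨ ≡.cong total (twice-suc (suc n)) ⟩
    total (suc (suc (2 ℕ.* suc n)))             ≈⟨ total-suc-suc (opp-fixpoint-free (suc n)) ⟩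
    r * A (suc n) + _                           ≈⟨ +-congˡ (∑-all-points-even n s t) ⟩
    r * A (suc n) + (2 ℕ.* suc n) · (s * A n + t * H n) ∎

  H-zero : H 0 ≈ 0#
  H-zero = asymmetricSum-suc (opp-fixpoint-free 0)

  H-suc : ∀ n → H (suc n) ≈ (2 ℕ.* suc n) · ((t * t) * A n + t * H n)
  H-suc n = begin
    asymmetricSum (suc (2 ℕ.* suc n))           ≈⟨ asymmetricSum-suc (opp-fixpoint-free (suc n)) ⟩
    _                                           ≈⟨ ∑-all-points-even n (t * t) t ⟩
    (2 ℕ.* suc n) · ((t * t) * A n + t * H n)   ∎

module SeriesCalculus {c ℓ} (R : CommutativeRing c ℓ) where

  open import Data.Nat as ℕ using (ℕ; zero; suc; _∸_; _<_)
  import Data.Nat.Properties as ℕ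
  open import Data.Nat.Combinatorics using (_C_; nCk+nC[k+1]≡[n+1]C[k+1])
  open import Data.Nat.Combinatorics.Specification using (k>n⇒nCk≡0)
  open import Data.List using ([]; _∷_; map; foldr; upTo; _∷ʳ_; zipWith)
  open import Data.List.Properties using (map-applyUpTo; upTo-∷ʳ)
  open import Data.List.Membership.Propositional.Properties using (∈-upTo⁻)
  open import Function using (_∘_)
  open import Relation.Binary.PropositionalEquality as ≡ using (_≡_)

  open CommutativeRing R
  open ListSum semiring
  open EGF R using (_⊛_)
  open import Algebra.Definitions.RawSemiring (Semiring.rawSemiring semiring) using () renaming (_×_ to _·_)
  open import Algebra.Properties.Semiring.Mult semiring using (×-homo-+; ×-congʳ; ×-comm-*)
  open import Algebra.Properties.CommutativeMonoid.Mult +-commutativeMonoid using (×-distrib-+)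
  open import Algebra.Properties.CommutativeSemigroup *-commutativeSemigroup using (x∙yz≈y∙xz)
  open import Algebra.Properties.CommutativeSemigroup +-commutativeSemigroup using () renaming (x∙yz≈y∙xz to x+yz≈y+xz)
  open import Relation.Binary.Reasoning.Setoid setoid

  ∑-upTo-suc : ∀ n (f : ℕ → Carrier) → ∑ (upTo (suc n)) f ≈ f 0 + ∑ (upTo n) (f ∘ suc)
  ∑-upTo-suc n f = +-congˡ (reflexive (≡.cong (foldr _+_ 0#)
    (≡.trans (map-applyUpTo suc f n) (≡.sym (map-applyUpTo (λ k → k) (f ∘ suc) n)))))

  ∑-upTo-last : ∀ n (f : ℕ → Carrier) → ∑ (upTo (suc n)) f ≈ ∑ (upTo n) f + f n
  ∑-upTo-last n f = begin
    ∑ (upTo (suc n)) f      ≡⟨ ≡.cong (λ xs → ∑ xs f) (upTo-∷ʳ n) ⟨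
    ∑ (upTo n ∷ʳ n) f       ≈⟨ ∑-++ (upTo n) (n ∷ []) f ⟩
    ∑ (upTo n) f + (f n + 0#) ≈⟨ +-congˡ (+-identityʳ (f n)) ⟩
    ∑ (upTo n) f + f n      ∎

  ∑-upTo-cong : ∀ n {f g : ℕ → Carrier} → (∀ {k} → k < n → f k ≈ g k) → ∑ (upTo n) f ≈ ∑ (upTo n) g
  ∑-upTo-cong n f≈g = ∑-cong (upTo n) (f≈g ∘ ∈-upTo⁻)

  ·-zeroʳ : ∀ m → m · 0# ≈ 0#
  ·-zeroʳ zero    = refl
  ·-zeroʳ (suc m) = trans (+-identityˡ _) (·-zeroʳ m)

  -- On exponential generating functions D is d/dx and X is multiplication by x.
  D : (ℕ → Carrier) → ℕ → Carrier
  D a = a ∘ suc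

  X : (ℕ → Carrier) → ℕ → Carrier
  X a k = k · a (k ∸ 1)

  D-X : ∀ a k → D (X a) k ≈ a k + X (D a) k
  D-X a zero    = refl
  D-X a (suc k) = refl

  ⊛-summand : (ℕ → Carrier) → (ℕ → Carrier) → ℕ → ℕ → Carrier
  ⊛-summand a b n k = (n C k) · (a k * b (n ∸ k))

  ⊛-cong : ∀ {a a′ b b′} → (∀ k → a k ≈ a′ k) → (∀ k → b k ≈ b′ k) → ∀ n → (a ⊛ b) n ≈ (a′ ⊛ b′) n
  ⊛-cong a≈a′ b≈b′ n = ∑-cong (upTo (suc n)) (λ {k} _ → ×-congʳ (n C k) (*-cong (a≈a′ k) (b≈b′ (n ∸ k))))

  ⊛-distribʳ-+ : ∀ a a′ b n → ((λ k → a k + a′ k) ⊛ b) n ≈ (a ⊛ b) n + (a′ ⊛ b) n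
  ⊛-distribʳ-+ a a′ b n = trans
    (∑-cong (upTo (suc n)) (λ {k} _ → trans (×-congʳ (n C k) (distribʳ (b (n ∸ k)) (a k) (a′ k)))
                                            (×-distrib-+ (a k * b (n ∸ k)) (a′ k * b (n ∸ k)) (n C k))))
    (∑-distrib-+ (upTo (suc n)) (⊛-summand a b n) (⊛-summand a′ b n))

  ⊛-distribˡ-+ : ∀ a b b′ n → (a ⊛ (λ k → b k + b′ k)) n ≈ (a ⊛ b) n + (a ⊛ b′) n
  ⊛-distribˡ-+ a b b′ n = trans
    (∑-cong (upTo (suc n)) (λ {k} _ → trans (×-congʳ (n C k) (distribˡ (a k) (b (n ∸ k)) (b′ (n ∸ k))))
                                            (×-distrib-+ (a k * b (n ∸ k)) (a k * b′ (n ∸ k)) (n C k))))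
    (∑-distrib-+ (upTo (suc n)) (⊛-summand a b n) (⊛-summand a b′ n))

  ⊛-*ˡ : ∀ x a b n → ((λ k → x * a k) ⊛ b) n ≈ x * (a ⊛ b) n
  ⊛-*ˡ x a b n = trans
    (∑-cong (upTo (suc n)) (λ {k} _ → trans (×-congʳ (n C k) (*-assoc x (a k) (b (n ∸ k))))
                                            (sym (×-comm-* (n C k) x (a k * b (n ∸ k))))))
    (∑-*ˡ (upTo (suc n)) x (⊛-summand a b n))

  ⊛-*ʳ : ∀ x a b n → (a ⊛ (λ k → x * b k)) n ≈ x * (a ⊛ b) n
  ⊛-*ʳ x a b n = trans
    (∑-cong (upTo (suc n)) (λ {k} _ → trans (×-congʳ (n C k) (x∙yz≈y∙xz (a k) x (b (n ∸ k))))
                                            (sym (×-comm-* (n C k) x (a k * b (n ∸ k))))))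
    (∑-*ˡ (upTo (suc n)) x (⊛-summand a b n))

  ⊛-leibniz : ∀ a b n → (a ⊛ b) (suc n) ≈ (D a ⊛ b) n + (a ⊛ D b) n
  ⊛-leibniz a b n = begin
    (a ⊛ b) (suc n)
      ≈⟨ ∑-upTo-suc (suc n) (⊛-summand a b (suc n)) ⟩
    T₀ + ∑[ j ∈ upTo (suc n) ] ⊛-summand a b (suc n) (suc j)
      ≈⟨ +-congˡ (∑-cong (upTo (suc n)) (λ {j} _ → trans
           (reflexive (≡.cong (_· Y j) (≡.sym (nCk+nC[k+1]≡[n+1]C[k+1] n j))))
           (×-homo-+ (Y j) (n C j) (n C suc j)))) ⟩
    T₀ + ∑[ j ∈ upTo (suc n) ] ((n C j) · Y j + V j)
      ≈⟨ +-congˡ (∑-distrib-+ (upTo (suc n)) (λ j → (n C j) · Y j) V) ⟩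
    T₀ + ((D a ⊛ b) n + ∑ (upTo (suc n)) V)
      ≈⟨ +-congˡ (+-congˡ (trans (∑-upTo-last n V) (trans (+-congˡ V-last) (+-identityʳ _)))) ⟩
    T₀ + ((D a ⊛ b) n + ∑ (upTo n) V)
      ≈⟨ x+yz≈y+xz _ _ _ ⟩
    (D a ⊛ b) n + (T₀ + ∑ (upTo n) V)
      ≈⟨ +-congˡ (+-congˡ (∑-upTo-cong n (λ {j} j<n →
           ×-congʳ (n C suc j) (*-congˡ (reflexive (≡.cong b (ℕ.+-∸-assoc 1 j<n))))))) ⟩
    (D a ⊛ b) n + (T₀ + ∑[ j ∈ upTo n ] ⊛-summand a (D b) n (suc j))
      ≈⟨ +-congˡ (∑-upTo-suc n (⊛-summand a (D b) n)) ⟨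
    (D a ⊛ b) n + (a ⊛ D b) n ∎
    where
    Y : ℕ → Carrier
    Y j = a (suc j) * b (n ∸ j)
    V : ℕ → Carrier
    V j = (n C suc j) · Y j
    T₀ : Carrier
    T₀ = ⊛-summand a b (suc n) 0
    V-last : V n ≈ 0#
    V-last = reflexive (≡.cong (_· Y n) (k>n⇒nCk≡0 (ℕ.n<1+n n)))

  private
    ·-leibniz : ∀ a b n → n · (D a ⊛ b) (n ∸ 1) + n · (a ⊛ D b) (n ∸ 1) ≈ n · (a ⊛ b) n
    ·-leibniz a b zero    = +-identityˡ 0#
    ·-leibniz a b (suc n) = trans (sym (×-distrib-+ _ _ (suc n))) (×-congʳ (suc n) (sym (⊛-leibniz a b n)))

  ⊛-Xˡ : ∀ n a b → (X a ⊛ b) n ≈ X (a ⊛ b) n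
  ⊛-Xˡ zero    a b = trans (+-identityʳ _) (trans (+-identityʳ _) (zeroˡ (b 0)))
  ⊛-Xˡ (suc n) a b = begin
    (X a ⊛ b) (suc n)
      ≈⟨ ⊛-leibniz (X a) b n ⟩
    (D (X a) ⊛ b) n + (X a ⊛ D b) n
      ≈⟨ +-cong (trans (⊛-cong {b = b} {b′ = b} (D-X a) (λ _ → refl) n) (⊛-distribʳ-+ a (X (D a)) b n)) (⊛-Xˡ n a (D b)) ⟩
    ((a ⊛ b) n + (X (D a) ⊛ b) n) + X (a ⊛ D b) n
      ≈⟨ +-congʳ (+-congˡ (⊛-Xˡ n (D a) b)) ⟩
    ((a ⊛ b) n + X (D a ⊛ b) n) + X (a ⊛ D b) n
      ≈⟨ +-assoc _ _ _ ⟩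
    (a ⊛ b) n + (X (D a ⊛ b) n + X (a ⊛ D b) n)
      ≈⟨ +-congˡ (·-leibniz a b n) ⟩
    X (a ⊛ b) (suc n) ∎

  ⊛-Xʳ : ∀ n a b → (a ⊛ X b) n ≈ X (a ⊛ b) n
  ⊛-Xʳ zero    a b = trans (+-identityʳ _) (trans (+-identityʳ _) (zeroʳ (a 0)))
  ⊛-Xʳ (suc n) a b = begin
    (a ⊛ X b) (suc n)
      ≈⟨ ⊛-leibniz a (X b) n ⟩
    (D a ⊛ X b) n + (a ⊛ D (X b)) n
      ≈⟨ +-cong (⊛-Xʳ n (D a) b) (trans (⊛-cong {a = a} {a′ = a} (λ _ → refl) (D-X b) n) (⊛-distribˡ-+ a b (X (D b)) n)) ⟩
    X (D a ⊛ b) n + ((a ⊛ b) n + (a ⊛ X (D b)) n)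
      ≈⟨ +-congˡ (+-congˡ (⊛-Xʳ n a (D b))) ⟩
    X (D a ⊛ b) n + ((a ⊛ b) n + X (a ⊛ D b) n)
      ≈⟨ x+yz≈y+xz _ _ _ ⟩
    (a ⊛ b) n + (X (D a ⊛ b) n + X (a ⊛ D b) n)
      ≈⟨ +-congˡ (·-leibniz a b n) ⟩
    X (a ⊛ b) (suc n) ∎

  open EGF R using (expUpTo; expEGF)

  expUpTo-spec : ∀ g n → expUpTo g n ≡ map (λ k → expEGF g (n ∸ k)) (upTo (suc n))
  expUpTo-spec g zero    = ≡.refl
  expUpTo-spec g (suc n) = ≡.cong (expEGF g (suc n) ∷_) (≡.trans (expUpTo-spec g n)
    (≡.trans (map-applyUpTo (λ k → k) (λ k → expEGF g (n ∸ k)) (suc n))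
             (≡.sym (map-applyUpTo suc (λ k → expEGF g (suc n ∸ k)) (suc n)))))

  D-expEGF : ∀ g n → D (expEGF g) n ≡ (D g ⊛ expEGF g) n
  D-expEGF g n = ≡.cong (foldr _+_ 0#) (≡.trans
    (≡.cong (zipWith F (upTo (suc n))) (expUpTo-spec g n))
    (zipWith-diagonal (upTo (suc n))))
    where
    F : ℕ → Carrier → Carrier
    F k e = (n C k) · (g (suc k) * e)
    zipWith-diagonal : ∀ xs → zipWith F xs (map (λ k → expEGF g (n ∸ k)) xs) ≡ map (λ k → F k (expEGF g (n ∸ k))) xs
    zipWith-diagonal []       = ≡.refl
    zipWith-diagonal (x ∷ xs) = ≡.cong (F x (expEGF g (n ∸ x)) ∷_) (zipWith-diagonal xs)

module RightHandSide {c ℓ} (R : CommutativeRing c ℓ) (r s t : CommutativeRing.Carrier R) where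

  open import Data.Nat as ℕ using (ℕ; zero; suc)
  open import Data.Nat.Combinatorics using (_C_; nC1≡n)
  open import Data.Nat.Tactic.RingSolver using (solve-∀)
  open import Data.List using (upTo)
  open import Relation.Binary.PropositionalEquality as ≡ using (_≡_)

  open CommutativeRing R
  open SeriesCalculus R
  open ListSum semiring
  open EGF R using (_⊛_; expEGF; exponent; invSqrt1m2tx; oddFact)
  open import Algebra.Definitions.RawSemiring (Semiring.rawSemiring semiring) using (_^_) renaming (_×_ to _·_)
  open import Algebra.Properties.Semiring.Mult semiring using (×-homo-+; ×-congʳ; ×-comm-*; ×-assoc-*; ×-assocˡ)
  open import Algebra.Properties.CommutativeMonoid.Mult +-commutativeMonoid using (×-distrib-+)
  open import Algebra.Properties.CommutativeSemigroup +-commutativeSemigroup using (interchange)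
  open import Relation.Binary.Reasoning.Setoid setoid

  private
    g : ℕ → Carrier
    g = exponent r s t
    E : ℕ → Carrier
    E = expEGF g
    h : ℕ → Carrier
    h = invSqrt1m2tx t

  c₂ : Carrier
  c₂ = 2 · (s - t * t)

  D-exponent-⊛ : ∀ e n → (D g ⊛ e) n ≈ (r - t) * e n + c₂ * X e n
  D-exponent-⊛ e n = begin
    (D g ⊛ e) n                                        ≈⟨ ∑-upTo-suc n (⊛-summand (D g) e n) ⟩
    ((r - t) * e n + 0#) + ∑[ j ∈ upTo n ] ⊛-summand (D g) e n (suc j) ≈⟨ +-cong (+-identityʳ _) (tail n) ⟩
    (r - t) * e n + c₂ * X e n                         ∎
    where
    tail : ∀ n → ∑[ j ∈ upTo n ] ⊛-summand (D g) e n (suc j) ≈ c₂ * X e n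
    tail zero    = sym (zeroʳ c₂)
    tail (suc m) = begin
      ∑[ j ∈ upTo (suc m) ] ⊛-summand (D g) e (suc m) (suc j)
        ≈⟨ ∑-upTo-suc m (λ j → ⊛-summand (D g) e (suc m) (suc j)) ⟩
      (suc m C 1) · (c₂ * e m) + ∑[ i ∈ upTo m ] ⊛-summand (D g) e (suc m) (suc (suc i))
        ≈⟨ +-cong (reflexive (≡.cong (_· (c₂ * e m)) (nC1≡n (suc m))))
                  (trans (∑-cong (upTo m) (λ {i} _ →
                            trans (×-congʳ (suc m C suc (suc i)) (zeroˡ _)) (·-zeroʳ (suc m C suc (suc i)))))
                         (∑-zero (upTo m))) ⟩
      suc m · (c₂ * e m) + 0#
        ≈⟨ trans (+-identityʳ _) (sym (×-comm-* (suc m) c₂ (e m))) ⟩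
      c₂ * X e (suc m) ∎

  D-invSqrt : ∀ k → D h k ≈ t * h k + (2 · t) * X (D h) k
  D-invSqrt k = begin
    ((2 ℕ.* k ℕ.+ 1) ℕ.* o) · u                ≡⟨ ≡.cong (_· u) (odd-step k o) ⟩
    (o ℕ.+ 2 ℕ.* (k ℕ.* o)) · u                ≈⟨ ×-homo-+ u o (2 ℕ.* (k ℕ.* o)) ⟩
    o · u + (2 ℕ.* (k ℕ.* o)) · u              ≈⟨ +-cong (sym (×-comm-* o t (t ^ k))) (sym doubled) ⟩
    t * h k + (2 · t) * (k · h k)              ≡⟨ ≡.cong (λ z → t * h k + (2 · t) * z) (X-D-h k) ⟨
    t * h k + (2 · t) * X (D h) k              ∎
    where
    o : ℕ
    o = oddFact k
    u : Carrier
    u = t * t ^ k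
    odd-step : ∀ k o → (2 ℕ.* k ℕ.+ 1) ℕ.* o ≡ o ℕ.+ 2 ℕ.* (k ℕ.* o)
    odd-step = solve-∀
    X-D-h : ∀ k → X (D h) k ≡ k · h k
    X-D-h zero    = ≡.refl
    X-D-h (suc k) = ≡.refl
    doubled : (2 · t) * (k · h k) ≈ (2 ℕ.* (k ℕ.* o)) · u
    doubled = trans (×-assoc-* 2 t (k · h k)) (trans (×-congʳ 2 (×-comm-* k t (h k)))
              (trans (×-congʳ 2 (×-congʳ k (×-comm-* o t (t ^ k))))
              (trans (×-congʳ 2 (×-assocˡ u k o)) (×-assocˡ u 2 (k ℕ.* o)))))

  private
    minus-plus : ∀ x y → x - y + y ≈ x
    minus-plus x y = trans (+-assoc x (- y) y) (trans (+-congˡ (-‿inverseˡ y)) (+-identityʳ x))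
    plus-minus : ∀ x y → (y + x) - y ≈ x
    plus-minus x y =
      trans (+-congʳ (+-comm y x)) (trans (+-assoc x y (- y)) (trans (+-congˡ (-‿inverseʳ y)) (+-identityʳ x)))
    two-·-* : ∀ m (x y : Carrier) → (2 · x) * (m · y) ≈ (2 ℕ.* m) · (x * y)
    two-·-* m x y = trans (×-assoc-* 2 x (m · y)) (trans (×-congʳ 2 (×-comm-* m x y)) (×-assocˡ (x * y) 2 m))

  ρ G η : ℕ → Carrier
  ρ = E ⊛ h
  G = E ⊛ D h
  η n = G n - t * ρ n

  ρ-zero : ρ 0 ≈ 1#
  ρ-zero = trans (+-identityʳ _) (trans (+-identityʳ _) (trans (*-identityˡ _) (+-identityʳ _)))

  ρ-suc : ∀ n → ρ (suc n) ≈ ((r - t) * ρ n + c₂ * X ρ n) + G n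
  ρ-suc n = begin
    ρ (suc n)                                             ≈⟨ ⊛-leibniz E h n ⟩
    (D E ⊛ h) n + G n                                     ≈⟨ +-congʳ (⊛-cong {b = h} {b′ = h} D-E (λ _ → refl) n) ⟩
    ((λ k → (r - t) * E k + c₂ * X E k) ⊛ h) n + G n      ≈⟨ +-congʳ (⊛-distribʳ-+ (λ k → (r - t) * E k) (λ k → c₂ * X E k) h n) ⟩
    ((λ k → (r - t) * E k) ⊛ h) n + ((λ k → c₂ * X E k) ⊛ h) n + G n
      ≈⟨ +-congʳ (+-cong (⊛-*ˡ (r - t) E h n) (trans (⊛-*ˡ c₂ (X E) h n) (*-congˡ (⊛-Xˡ n E h)))) ⟩
    ((r - t) * ρ n + c₂ * X ρ n) + G n                   ∎
    where
    D-E : ∀ k → D E k ≈ (r - t) * E k + c₂ * X E k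
    D-E k = trans (reflexive (D-expEGF g k)) (D-exponent-⊛ E k)

  G-X : ∀ n → G n ≈ t * ρ n + (2 · t) * X G n
  G-X n = begin
    G n                                                  ≈⟨ ⊛-cong {a = E} {a′ = E} (λ _ → refl) D-invSqrt n ⟩
    (E ⊛ (λ k → t * h k + (2 · t) * X (D h) k)) n        ≈⟨ ⊛-distribˡ-+ E (λ k → t * h k) (λ k → (2 · t) * X (D h) k) n ⟩
    (E ⊛ (λ k → t * h k)) n + (E ⊛ (λ k → (2 · t) * X (D h) k)) n
      ≈⟨ +-cong (⊛-*ʳ t E h n) (trans (⊛-*ʳ (2 · t) E (X (D h)) n) (*-congˡ (⊛-Xʳ n E (D h)))) ⟩
    t * ρ n + (2 · t) * X G n                            ∎

  private
    G≈η+tρ : ∀ n → G n ≈ η n + t * ρ n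
    G≈η+tρ n = sym (minus-plus (G n) (t * ρ n))

    η-X : ∀ n → η n ≈ (2 · t) * X G n
    η-X n = trans (+-congʳ (G-X n)) (plus-minus _ (t * ρ n))

  η-zero : η 0 ≈ 0#
  η-zero = trans (η-X 0) (zeroʳ _)

  η-suc : ∀ n → η (suc n) ≈ (2 ℕ.* suc n) · ((t * t) * ρ n + t * η n)
  η-suc n = begin
    η (suc n)                                 ≈⟨ η-X (suc n) ⟩
    (2 · t) * (suc n · G n)                   ≈⟨ two-·-* (suc n) t (G n) ⟩
    (2 ℕ.* suc n) · (t * G n)                 ≈⟨ ×-congʳ (2 ℕ.* suc n) (*-congˡ (G≈η+tρ n)) ⟩
    (2 ℕ.* suc n) · (t * (η n + t * ρ n))     ≈⟨ ×-congʳ (2 ℕ.* suc n) (trans (distribˡ t (η n) (t * ρ n)) (+-comm _ _)) ⟩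
    (2 ℕ.* suc n) · (t * (t * ρ n) + t * η n) ≈⟨ ×-congʳ (2 ℕ.* suc n) (+-congʳ (sym (*-assoc t t (ρ n)))) ⟩
    (2 ℕ.* suc n) · ((t * t) * ρ n + t * η n) ∎

  private
    ρ-suc′ : ∀ n → ρ (suc n) ≈ r * ρ n + (c₂ * X ρ n + η n)
    ρ-suc′ n = begin
      ρ (suc n)                                         ≈⟨ ρ-suc n ⟩
      ((r - t) * ρ n + c₂ * X ρ n) + G n                ≈⟨ +-congˡ (G≈η+tρ n) ⟩
      ((r - t) * ρ n + c₂ * X ρ n) + (η n + t * ρ n)    ≈⟨ +-congˡ (+-comm (η n) (t * ρ n)) ⟩
      ((r - t) * ρ n + c₂ * X ρ n) + (t * ρ n + η n)    ≈⟨ interchange _ _ _ _ ⟩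
      ((r - t) * ρ n + t * ρ n) + (c₂ * X ρ n + η n)    ≈⟨ +-congʳ (trans (sym (distribʳ (ρ n) (r - t) t)) (*-congʳ (minus-plus r t))) ⟩
      r * ρ n + (c₂ * X ρ n + η n)                      ∎

  ρ-one : ρ 1 ≈ r * ρ 0
  ρ-one = trans (ρ-suc′ 0)
    (trans (+-congˡ (trans (+-congʳ (zeroʳ c₂)) (trans (+-identityˡ _) η-zero))) (+-identityʳ _))

  ρ-suc-suc : ∀ n → ρ (suc (suc n)) ≈ r * ρ (suc n) + (2 ℕ.* suc n) · (s * ρ n + t * η n)
  ρ-suc-suc n = trans (ρ-suc′ (suc n)) (+-congˡ (begin
    c₂ * (suc n · ρ n) + η (suc n)
      ≈⟨ +-cong (two-·-* (suc n) (s - t * t) (ρ n)) (η-suc n) ⟩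
    m · ((s - t * t) * ρ n) + m · ((t * t) * ρ n + t * η n)
      ≈⟨ ×-distrib-+ _ _ m ⟨
    m · ((s - t * t) * ρ n + ((t * t) * ρ n + t * η n))
      ≈⟨ ×-congʳ m (trans (sym (+-assoc _ _ _))
           (+-congʳ (trans (sym (distribʳ (ρ n) (s - t * t) (t * t))) (*-congʳ (minus-plus s (t * t)))))) ⟩
    m · (s * ρ n + t * η n) ∎))
    where
    m : ℕ
    m = 2 ℕ.* suc n

module Agreement {c ℓ} (R : CommutativeRing c ℓ) (r s t : CommutativeRing.Carrier R) where

  open import Data.Nat as ℕ using (ℕ; zero; suc)
  open import Data.Product using (_×_; _,_; proj₁)

  open CommutativeRing R
  open EvenRecurrences R r s t
  open RightHandSide R r s t
  open import Algebra.Properties.Semiring.Mult semiring using (×-congʳ)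

  coefficients-agree : ∀ n → (A n ≈ ρ n) × (A (suc n) ≈ ρ (suc n)) × (H n ≈ η n)
  coefficients-agree zero = A₀≈ρ₀ , A₁≈ρ₁ , trans H-zero (sym η-zero)
    where
    A₀≈ρ₀ : A 0 ≈ ρ 0
    A₀≈ρ₀ = trans A-zero (sym ρ-zero)
    A₁≈ρ₁ : A 1 ≈ ρ 1
    A₁≈ρ₁ = trans A-one (trans (*-congˡ A₀≈ρ₀) (sym ρ-one))
  coefficients-agree (suc n) with coefficients-agree n
  ... | Aₙ≈ρₙ , Aₙ₊₁≈ρₙ₊₁ , Hₙ≈ηₙ =
    Aₙ₊₁≈ρₙ₊₁ ,
    trans (A-suc-suc n) (trans (+-cong (*-congˡ Aₙ₊₁≈ρₙ₊₁) (×-congʳ (2 ℕ.* suc n) step-A)) (sym (ρ-suc-suc n))) ,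
    trans (H-suc n) (trans (×-congʳ (2 ℕ.* suc n) step-H) (sym (η-suc n)))
    where
    step-A : s * A n + t * H n ≈ s * ρ n + t * η n
    step-A = +-cong (*-congˡ Aₙ≈ρₙ) (*-congˡ Hₙ≈ηₙ)
    step-H : (t * t) * A n + t * H n ≈ (t * t) * ρ n + t * η n
    step-H = +-cong (*-congˡ Aₙ≈ρₙ) (*-congˡ Hₙ≈ηₙ)

  lhsCoeff≈rhsCoeff : ∀ n → A n ≈ ρ n
  lhsCoeff≈rhsCoeff n = proj₁ (coefficients-agree n)

theorem5p1 : ∀ {c ℓ} (R : CommutativeRing c ℓ) → (r s t : CommutativeRing.Carrier R) (n : ℕ) →
    CommutativeRing._≈_ R (EGF.lhsCoeff R r s t n) (EGF.rhsCoeff R r s t n)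
theorem5p1 = Agreement.lhsCoeff≈rhsCoeff
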